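{- If $n$ and $k$ are positive integers such that $k<n/2$ and $n$ is not a multiple of $5$, then the generalized Petersen graph $P(n,k)$ has a $(1,1,2,2)$-coloring, and hence $\chi_{\rho}(S(P(n,k)))\le 5$.
   Context: For positive integers $k<n/2$, the generalized Petersen graph $P(n,k)$ has vertex set $\{u_1,v_1,\ldots,u_n,v_n\}$ and edge set $\{u_iu_{i+1}: i\in[n]\}\cup\{u_iv_i: i\in[n]\}\cup\{v_iv_{i+k}: i\in[n]\}$, indices taken modulo $n$. For a positive integer $i$, an $i$-packing in a graph $H$ is a set of vertices any two distinct of which are at distance greater than $i$ in $H$. A $(1,1,2,2)$-coloring is a partition of $V(H)$ into four sets, two of which are independent sets and two of which are $2$-packings. The packing chromatic number $\chi_{\rho}(H)$ is the smallest $k$ such that $V(H)$ can be partitioned into sets $\Pi_1,\ldots,\Pi_k$ with $\Pi_i$ an $i$-packing. $S(H)$ is the subdivision of $H$, obtained by inserting one new vertex on each edge. -}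

module Defs where

open import Data.Nat using (ℕ; zero; suc; _+_; _≤_; NonZero)
open import Data.Nat.DivMod using (_mod_)
open import Data.Fin using (Fin; toℕ)
import Data.Fin as Fin
open import Data.Bool using (Bool; true; false)
open import Data.Product using (_×_; _,_; Σ; ∃; proj₁; proj₂)
open import Data.Sum using (_⊎_; inj₁; inj₂)
open import Relation.Binary.PropositionalEquality using (_≡_)
open import Relation.Nullary using (¬_)

record Graph : Set₁ where
  field
    V    : Set
    E    : Set
    ends : E → V × V

open Graph public

Adj : (G : Graph) → V G → V G → Set
Adj G x y = Σ (E G) λ e → (ends G e ≡ (x , y)) ⊎ (ends G e ≡ (y , x))

data Walk (G : Graph) : V G → V G → ℕ → Set where
  here : ∀ {x} → Walk G x x zero
  step : ∀ {x y z m} → Adj G x y → Walk G y z m → Walk G x z (suc m)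

DistLe : (G : Graph) → V G → V G → ℕ → Set
DistLe G x y i = Σ ℕ λ m → (m ≤ i) × Walk G x y m

IsPacking : (G : Graph) → ℕ → (V G → Set) → Set
IsPacking G i S = ∀ x y → S x → S y → ¬ (x ≡ y) → ¬ DistLe G x y i

Class : ∀ {A : Set} {m} → (A → Fin m) → Fin m → A → Set
Class c j x = c x ≡ j

Has1122Coloring : Graph → Set
Has1122Coloring G = Σ (V G → Fin 4) λ c →
  IsPacking G 1 (Class c Fin.zero) ×
  IsPacking G 1 (Class c (Fin.suc Fin.zero)) ×
  IsPacking G 2 (Class c (Fin.suc (Fin.suc Fin.zero))) ×
  IsPacking G 2 (Class c (Fin.suc (Fin.suc (Fin.suc Fin.zero))))

-- χ_ρ(G) ≤ m : partition V(G) into Π_1,…,Π_m with Π_i an i-packing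
-- (classes may be empty; class j : Fin m corresponds to Π_{j+1}).
PackingChromaticLe : Graph → ℕ → Set
PackingChromaticLe G m = Σ (V G → Fin m) λ c →
  ∀ (j : Fin m) → IsPacking G (suc (toℕ j)) (Class c j)

Subdivision : Graph → Graph
Subdivision G = record
  { V = V G ⊎ E G
  ; E = E G × Bool
  ; ends = λ { (e , false) → (inj₁ (proj₁ (ends G e)) , inj₂ e)
             ; (e , true)  → (inj₂ e , inj₁ (proj₂ (ends G e))) } }

-- Generalized Petersen graph P(n,k).
-- Vertices (false , i) = u_i, (true , i) = v_i  (indices in Fin n, mod n).
-- Edges (0 , i) = u_i u_{i+1}, (1 , i) = u_i v_i, (2 , i) = v_i v_{i+k}.
addMod : (n : ℕ) .{{_ : NonZero n}} → Fin n → ℕ → Fin n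
addMod n i d = (toℕ i + d) mod n

Petersen : (n k : ℕ) .{{_ : NonZero n}} → Graph
Petersen n k = record
  { V = Bool × Fin n
  ; E = Fin 3 × Fin n
  ; ends = pe }
  where
  pe : Fin 3 × Fin n → (Bool × Fin n) × (Bool × Fin n)
  pe (Fin.zero , i) = ((false , i) , (false , addMod n i 1))
  pe (Fin.suc Fin.zero , i) = ((false , i) , (true , i))
  pe (Fin.suc (Fin.suc _) , i) = ((true , i) , (true , addMod n i k))

-- Color the rim u_0 … u_{n-1} alternately with the two independent colors and give each
-- v_i either the independent color not used on u_i or one of the 2-packing colors A, B; for
-- odd n the last rim vertex takes A instead. Every (1,1,2,2)-condition then becomes local along
-- the inner cycles v_i v_{i+k}: two adjacent v's with the independent color need rim indices of
-- opposite parity, and A (or B) must not repeat within two inner steps, nor sit near u_{n-1}.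
-- For even n the inner graph consists of gcd(n,k) cycles of length L = n / gcd(n,k), and 5 ∤ n
-- gives L ≠ 5, hence L = 4a + 3b: each cycle is colored by a blocks AWBW followed by b blocks AWB,
-- positions along a cycle being read off from a Bézout inverse of k / gcd(n,k) modulo L.
-- For odd n the pattern is explicit, separately for n = 2k + 1 and n ≥ 2k + 3 when k is odd, and
-- for n = 2k + 1 (where 5 ∤ n forces k ≥ 4), 2k + 3 ≤ n < 3k and n > 3k when k is even.
-- Subdividing doubles distances and makes the new vertices independent, so shifting the colors
-- up by one turns a (1,1,2,2)-coloring into a packing 5-coloring of the subdivision.

module Submission where

open import Defs
open import Data.Nat
  using (ℕ; zero; suc; _+_; _*_; _∸_; _≤_; _<_; z≤n; s≤s; NonZero; ≢-nonZero; >-nonZero; ≢-nonZero⁻¹;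
         parity; _≤?_; _<?_; _≟_)
open import Data.Nat.Properties
open import Data.Nat.DivMod
  using (_/_; _%_; m<n⇒m%n≡m; [m+n]%n≡m%n; [m+kn]%n≡m%n; %-distribˡ-+; m%n%n≡m%n; m%n<n;
         +-distrib-/-∣ʳ; m/n*n≡m; m/n≡1+[m∸n]/n; m<n⇒m/n≡0; n/n≡1)
open import Data.Nat.Divisibility using (_∣_; divides; ∣m∣n⇒∣m+n)
open import Data.Nat.GCD using (gcd; gcd[m,n]∣m; gcd[m,n]∣n; gcd[m,n]≢0; module Bézout)
open import Data.Nat.Coprimality using (coprime-/gcd; coprime-Bézout)
open import Data.Nat.Tactic.RingSolver using (solve-∀)
open import Data.Parity.Base using (Parity; 0ℙ; 1ℙ; _⁻¹) renaming (_+_ to _⊕_)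
import Data.Parity.Properties as ℙ
open import Data.Fin using (Fin; toℕ)
import Data.Fin as Fin
import Data.Fin.Properties as Fin
open import Data.Bool using (Bool; true; false; T; if_then_else_)
open import Data.Unit using (⊤; tt)
open import Data.Product using (∃-syntax; _×_; _,_; proj₁; proj₂)
open import Data.Sum using (_⊎_; inj₁; inj₂)
open import Data.Empty using (⊥; ⊥-elim)
open import Function using (_∘_)
open import Relation.Nullary using (¬_; Dec; does; yes; no; contradiction)
open import Relation.Nullary.Decidable using (dec-true; dec-false)
open import Relation.Binary using (tri<; tri≈; tri>)
open import Relation.Binary.PropositionalEquality

-- Subdivisions

module _ (G : Graph) where

  private
    S : Graph
    S = Subdivision G

  Incident : V G → E G → Set
  Incident x e = proj₁ (ends G e) ≡ x ⊎ proj₂ (ends G e) ≡ x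

  subdivision-adj-old : ∀ {x w} → Adj S (inj₁ x) w → ∃[ e ] w ≡ inj₂ e × Incident x e
  subdivision-adj-old ((e , false) , inj₁ refl) = e , refl , inj₁ refl
  subdivision-adj-old ((e , true)  , inj₂ refl) = e , refl , inj₂ refl

  subdivision-adj-new : ∀ {e w} → Adj S (inj₂ e) w → ∃[ z ] w ≡ inj₁ z × Incident z e
  subdivision-adj-new ((e , false) , inj₂ refl) = _ , refl , inj₁ refl
  subdivision-adj-new ((e , true)  , inj₁ refl) = _ , refl , inj₂ refl

  subdivision-new-independent : ∀ {e e′} → ¬ Adj S (inj₂ e) (inj₂ e′)
  subdivision-new-independent a with subdivision-adj-new a
  ... | _ , () , _

  HalfWalk : V G → V G → ℕ → Set
  HalfWalk x y m = ∃[ m′ ] m′ + m′ ≤ m × Walk G x y m′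

  private
    ≤-step² : ∀ {a b} → a ≤ b → a ≤ suc (suc b)
    ≤-step² a≤b = ≤-trans a≤b (≤-trans (n≤1+n _) (n≤1+n _))

    +-double-suc-≤ : ∀ {a b} → a + a ≤ b → suc a + suc a ≤ suc (suc b)
    +-double-suc-≤ {a} a+a≤b rewrite +-suc a a = s≤s (s≤s a+a≤b)

  HalfWalk-via-edge : ∀ {x y z e m} → Incident x e → Incident z e →
                      HalfWalk z y m → HalfWalk x y (suc (suc m))
  HalfWalk-via-edge (inj₁ refl) (inj₁ refl) (m′ , le , w) = m′ , ≤-step² le , w
  HalfWalk-via-edge (inj₂ refl) (inj₂ refl) (m′ , le , w) = m′ , ≤-step² le , w
  HalfWalk-via-edge {e = e} (inj₁ refl) (inj₂ refl) (m′ , le , w) =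
    suc m′ , +-double-suc-≤ le , step (e , inj₁ refl) w
  HalfWalk-via-edge {e = e} (inj₂ refl) (inj₁ refl) (m′ , le , w) =
    suc m′ , +-double-suc-≤ le , step (e , inj₂ refl) w

  halve-walk : ∀ {x y m} → Walk S (inj₁ x) (inj₁ y) m → HalfWalk x y m
  halve-walk here = zero , z≤n , here
  halve-walk (step a rest) with subdivision-adj-old a
  ... | e , refl , x∈e with rest
  ...   | step a′ rest′ with subdivision-adj-new a′
  ...     | z , refl , z∈e = HalfWalk-via-edge x∈e z∈e (halve-walk rest′)

  private
    m+m≤1+i+i⇒m≤i : ∀ {m i} → m + m ≤ suc (i + i) → m ≤ i
    m+m≤1+i+i⇒m≤i {m} {i} le with m ≤? i
    ... | yes m≤i = m≤i
    ... | no m≰i = contradiction (≤-trans (≤-reflexive (sym (+-suc (suc i) i)))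
                                   (≤-trans (+-mono-≤ i<m i<m) le)) (n≮n (suc (i + i)))
      where
      i<m : i < m
      i<m = ≰⇒> m≰i

  subdivision-packing : ∀ {i b} {P : V G → Set} {Q : V S → Set} →
    IsPacking G i P → b ≤ suc (i + i) →
    (∀ {x} → Q (inj₁ x) → P x) → (∀ {e} → ¬ Q (inj₂ e)) → IsPacking S b Q
  subdivision-packing P-pack b≤ Q⇒P Q-old (inj₁ x) (inj₁ y) qx qy x≢y (m , m≤b , w)
    with halve-walk w
  ... | m′ , m′+m′≤m , w′ =
    P-pack x y (Q⇒P qx) (Q⇒P qy) (λ x≡y → x≢y (cong inj₁ x≡y))
      (m′ , m+m≤1+i+i⇒m≤i (≤-trans m′+m′≤m (≤-trans m≤b b≤)) , w′)
  subdivision-packing _ _ _ Q-old (inj₁ x) (inj₂ e) _ qy = ⊥-elim (Q-old qy)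
  subdivision-packing _ _ _ Q-old (inj₂ e) _ qx = ⊥-elim (Q-old qx)

  packingChromatic-subdivision≤5 : Has1122Coloring G → PackingChromaticLe (Subdivision G) 5
  packingChromatic-subdivision≤5 (c , p₀ , p₁ , p₂ , p₃) = c′ , packing
    where
    c′ : V S → Fin 5
    c′ (inj₁ x) = Fin.suc (c x)
    c′ (inj₂ e) = Fin.zero

    lift : ∀ {i b} j → IsPacking G i (Class c j) → b ≤ suc (i + i) →
           IsPacking S b (Class c′ (Fin.suc j))
    lift j P-pack b≤ = subdivision-packing P-pack b≤ Fin.suc-injective (λ ())

    packing : ∀ j → IsPacking S (suc (toℕ j)) (Class c′ j)
    packing Fin.zero (inj₂ e) .(inj₂ e) _ _ e≢e (zero , _ , here) = e≢e refl
    packing Fin.zero (inj₂ e) (inj₂ e′) _ _ _ (suc zero , _ , step a here) =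
      subdivision-new-independent a
    packing Fin.zero _ _ _ _ _ (suc (suc _) , s≤s () , _)
    packing Fin.zero (inj₁ _) _ () _
    packing Fin.zero (inj₂ _) (inj₁ _) _ ()
    packing (Fin.suc Fin.zero) = lift _ p₀ (n≤1+n 2)
    packing (Fin.suc (Fin.suc Fin.zero)) = lift _ p₁ ≤-refl
    packing (Fin.suc (Fin.suc (Fin.suc Fin.zero))) = lift _ p₂ (n≤1+n 4)
    packing (Fin.suc (Fin.suc (Fin.suc (Fin.suc Fin.zero)))) = lift _ p₃ ≤-refl

module Cyclic (M : ℕ) .{{_ : NonZero M}} where

  ShiftedBy : ℕ → ℕ → ℕ → Set
  ShiftedBy δ i j = j ≡ i + δ ⊎ j + M ≡ i + δ

  AtShift : ℕ → (ℕ → ℕ → Set) → Set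
  AtShift δ R = ∀ i j → i < M → j < M → ShiftedBy δ i j → R i j

  %-below-double : ∀ {a} → a < M + M → a % M ≡ a ⊎ a % M + M ≡ a
  %-below-double {a} a<2M with a <? M
  ... | yes a<M = inj₁ (m<n⇒m%n≡m a<M)
  ... | no a≮M = inj₂ (begin
    a % M + M              ≡⟨ cong (λ b → b % M + M) (sym a∸M+M≡a) ⟩
    (a ∸ M + M) % M + M    ≡⟨ cong (_+ M) ([m+n]%n≡m%n (a ∸ M) M) ⟩
    (a ∸ M) % M + M        ≡⟨ cong (_+ M) (m<n⇒m%n≡m a∸M<M) ⟩
    a ∸ M + M              ≡⟨ a∸M+M≡a ⟩
    a                      ∎)
    where
    open ≡-Reasoning
    a∸M+M≡a : a ∸ M + M ≡ a
    a∸M+M≡a = m∸n+n≡m (≮⇒≥ a≮M)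
    a∸M<M : a ∸ M < M
    a∸M<M = +-cancelʳ-< M (a ∸ M) M (subst (_< M + M) (sym a∸M+M≡a) a<2M)

  %-shifted : ∀ {p δ} → p < M → δ ≤ M → ShiftedBy δ p ((p + δ) % M)
  %-shifted p<M δ≤M = %-below-double (+-mono-<-≤ p<M δ≤M)

  ShiftedBy-injective : ∀ {δ i i′ j} → i < M → i′ < M →
                        ShiftedBy δ i j → ShiftedBy δ i′ j → i ≡ i′
  ShiftedBy-injective {δ} {i} {i′} _ _ (inj₁ e) (inj₁ e′) = +-cancelʳ-≡ δ i i′ (trans (sym e) e′)
  ShiftedBy-injective {δ} {i} {i′} _ _ (inj₂ e) (inj₂ e′) = +-cancelʳ-≡ δ i i′ (trans (sym e) e′)
  ShiftedBy-injective {δ} {i} {i′} _ i′<M (inj₁ e) (inj₂ e′) =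
    contradiction (wrapped-≥ (trans (cong (_+ M) (sym e)) e′)) (<⇒≱ i′<M)
    where
    wrapped-≥ : i + δ + M ≡ i′ + δ → M ≤ i′
    wrapped-≥ h = +-cancelʳ-≤ δ M i′ (subst (M + δ ≤_) h
                    (subst (_≤ i + δ + M) (+-comm δ M) (+-monoˡ-≤ M (m≤n+m δ i))))
  ShiftedBy-injective i<M i′<M s@(inj₂ _) s′@(inj₁ _) = sym (ShiftedBy-injective i′<M i<M s′ s)

  wrapped-shift-< : ∀ {δ i j} → i < M → j + M ≡ i + δ → j < δ
  wrapped-shift-< {δ} {i} {j} i<M e =
    +-cancelˡ-< M j δ (subst (_< M + δ) (trans (sym e) (+-comm j M)) (+-monoˡ-< δ i<M))

  ShiftedBy-from-last : ∀ {δ i j} → suc i ≡ M → j < M → 0 < δ → ShiftedBy δ i j → suc j ≡ δ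
  ShiftedBy-from-last {δ} {i} {j} i+1≡M j<M δ>0 (inj₁ refl) =
    contradiction (subst (_≤ i + δ) (trans (+-comm i 1) i+1≡M) (+-monoʳ-≤ i δ>0)) (<⇒≱ j<M)
  ShiftedBy-from-last {δ} {i} {j} i+1≡M _ _ (inj₂ e) = +-cancelʳ-≡ i (suc j) δ (begin
    suc j + i    ≡⟨ sym (+-suc j i) ⟩
    j + suc i    ≡⟨ cong (j +_) i+1≡M ⟩
    j + M        ≡⟨ e ⟩
    i + δ        ≡⟨ +-comm i δ ⟩
    δ + i        ∎)
    where open ≡-Reasoning

  ShiftedBy-to-last : ∀ {δ i j} → suc j ≡ M → i < M → δ < M → ShiftedBy δ i j → suc (i + δ) ≡ M
  ShiftedBy-to-last j+1≡M _ _ (inj₁ refl) = j+1≡M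
  ShiftedBy-to-last {δ} {i} {j} j+1≡M i<M δ<M (inj₂ e) = contradiction
    (subst (λ m → suc m ≤ M + M) i+δ+1≡M+M (subst (_≤ M + M) (+-suc (suc i) δ) (+-mono-≤ i<M δ<M)))
    (n≮n (M + M))
    where
    i+δ+1≡M+M : suc (i + δ) ≡ M + M
    i+δ+1≡M+M = trans (cong suc (sym e)) (cong (_+ M) j+1≡M)

  %-add-mod : ∀ a d → (a % M + d) % M ≡ (a + d) % M
  %-add-mod a d = begin
    (a % M + d) % M           ≡⟨ %-distribˡ-+ (a % M) d M ⟩
    (a % M % M + d % M) % M   ≡⟨ cong (λ c → (c + d % M) % M) (m%n%n≡m%n a M) ⟩
    (a % M + d % M) % M       ≡⟨ sym (%-distribˡ-+ a d M) ⟩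
    (a + d) % M               ∎
    where open ≡-Reasoning

  %-cong-multiple : ∀ {a b s t} → a + s * M ≡ b + t * M → a % M ≡ b % M
  %-cong-multiple {a} {b} {s} {t} e =
    trans (sym ([m+kn]%n≡m%n a s M)) (trans (cong (_% M) e) ([m+kn]%n≡m%n b t M))

  *-shift-% : ∀ {x d c Y u v t} → x * d ≡ c + Y * M → u + d ≡ v + t * M →
              (x * v) % M ≡ (x * u + c) % M
  *-shift-% {x} {d} {c} {Y} {u} {v} {t} xd≡ ud≡ = %-cong-multiple {s = x * t} {t = Y} (begin
    x * v + x * t * M     ≡⟨ distrib x v t M ⟩
    x * (v + t * M)       ≡⟨ cong (x *_) (sym ud≡) ⟩
    x * (u + d)           ≡⟨ *-distribˡ-+ x u d ⟩
    x * u + x * d         ≡⟨ cong (x * u +_) xd≡ ⟩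
    x * u + (c + Y * M)   ≡⟨ sym (+-assoc (x * u) c (Y * M)) ⟩
    x * u + c + Y * M     ∎)
    where
    open ≡-Reasoning
    distrib : ∀ x v t M → x * v + x * t * M ≡ x * (v + t * M)
    distrib = solve-∀

  *-shift-%′ : ∀ {x d c Y u v t} → x * d + c ≡ Y * M → u + d ≡ v + t * M →
               (x * u) % M ≡ (x * v + c) % M
  *-shift-%′ {x} {d} {c} {Y} {u} {v} {t} xd≡ ud≡ = %-cong-multiple {s = Y} {t = x * t} (begin
    x * u + Y * M             ≡⟨ cong (x * u +_) (sym xd≡) ⟩
    x * u + (x * d + c)       ≡⟨ regroup x u d c ⟩
    x * (u + d) + c           ≡⟨ cong (λ w → x * w + c) ud≡ ⟩
    x * (v + t * M) + c       ≡⟨ distrib x v t M c ⟩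
    x * v + c + x * t * M     ∎)
    where
    open ≡-Reasoning
    regroup : ∀ x u d c → x * u + (x * d + c) ≡ x * (u + d) + c
    regroup = solve-∀
    distrib : ∀ x v t M c → x * (v + t * M) + c ≡ x * v + c + x * t * M
    distrib = solve-∀

module _ (n : ℕ) .{{_ : NonZero n}} where

  open Cyclic n

  toℕ-addMod : ∀ j d → toℕ (addMod n j d) ≡ (toℕ j + d) % n
  toℕ-addMod j d = Fin.toℕ-fromℕ< _

  addMod-shifted : ∀ j {δ} → δ ≤ n → ShiftedBy δ (toℕ j) (toℕ (addMod n j δ))
  addMod-shifted j {δ} δ≤n =
    subst (ShiftedBy δ (toℕ j)) (sym (toℕ-addMod j δ)) (%-shifted (Fin.toℕ<n j) δ≤n)

  addMod-addMod : ∀ j a b → addMod n (addMod n j a) b ≡ addMod n j (a + b)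
  addMod-addMod j a b = Fin.toℕ-injective (begin
    toℕ (addMod n (addMod n j a) b)  ≡⟨ toℕ-addMod (addMod n j a) b ⟩
    (toℕ (addMod n j a) + b) % n     ≡⟨ cong (λ c → (c + b) % n) (toℕ-addMod j a) ⟩
    ((toℕ j + a) % n + b) % n        ≡⟨ %-add-mod (toℕ j + a) b ⟩
    (toℕ j + a + b) % n              ≡⟨ cong (_% n) (+-assoc (toℕ j) a b) ⟩
    (toℕ j + (a + b)) % n            ≡⟨ sym (toℕ-addMod j (a + b)) ⟩
    toℕ (addMod n j (a + b))         ∎)
    where open ≡-Reasoning

  addMod-injective : ∀ {i j : Fin n} d → d ≤ n → addMod n i d ≡ addMod n j d → i ≡ j
  addMod-injective {i} {j} d d≤n eq = Fin.toℕ-injective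
    (ShiftedBy-injective (Fin.toℕ<n i) (Fin.toℕ<n j) (addMod-shifted i d≤n)
      (subst (ShiftedBy d (toℕ j)) (cong toℕ (sym eq)) (addMod-shifted j d≤n)))

p≢p⊕1 : ∀ p → p ≢ p ⊕ 1ℙ
p≢p⊕1 0ℙ ()
p≢p⊕1 1ℙ ()

parity-suc : ∀ q → parity (suc q) ≡ parity q ⁻¹
parity-suc q = sym (ℙ.⁻¹-selfInverse (ℙ.suc-homo-⁻¹ q))

parity-+-odd : ∀ i δ → parity δ ≡ 1ℙ → parity i ≢ parity (i + δ)
parity-+-odd i δ δ-odd e = p≢p⊕1 (parity i) (trans e (trans (ℙ.+-homo-+ i δ) (cong (parity i ⊕_) δ-odd)))

ShiftedBy-parity : ∀ {n} .{{_ : NonZero n}} {δ i j} → parity n ≡ 0ℙ →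
                   Cyclic.ShiftedBy n δ i j → parity j ≡ parity i ⊕ parity δ
ShiftedBy-parity {δ = δ} {i} _ (inj₁ refl) = ℙ.+-homo-+ i δ
ShiftedBy-parity {n} {δ} {i} {j} n-even (inj₂ e) = begin
  parity j                 ≡⟨ sym (ℙ.+-identityʳ (parity j)) ⟩
  parity j ⊕ 0ℙ            ≡⟨ cong (parity j ⊕_) (sym n-even) ⟩
  parity j ⊕ parity n      ≡⟨ sym (ℙ.+-homo-+ j n) ⟩
  parity (j + n)           ≡⟨ cong parity e ⟩
  parity (i + δ)           ≡⟨ ℙ.+-homo-+ i δ ⟩
  parity i ⊕ parity δ      ∎
  where open ≡-Reasoning

wrapped-parity : ∀ {n k i j} → parity n ≡ 1ℙ → parity k ≡ 0ℙ → j + n ≡ i + k → parity i ≢ parity j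
wrapped-parity {n} {k} {i} {j} n-odd k-even e i≡j = p≢p⊕1 (parity j) (begin
  parity j             ≡⟨ sym i≡j ⟩
  parity i             ≡⟨ sym (ℙ.+-identityʳ (parity i)) ⟩
  parity i ⊕ 0ℙ        ≡⟨ cong (parity i ⊕_) (sym k-even) ⟩
  parity i ⊕ parity k  ≡⟨ sym (ℙ.+-homo-+ i k) ⟩
  parity (i + k)       ≡⟨ cong parity (sym e) ⟩
  parity (j + n)       ≡⟨ ℙ.+-homo-+ j n ⟩
  parity j ⊕ parity n  ≡⟨ cong (parity j ⊕_) n-odd ⟩
  parity j ⊕ 1ℙ        ∎)
  where open ≡-Reasoning

parity-double : ∀ k → parity (k + k) ≡ 0ℙ
parity-double k = trans (ℙ.+-homo-+ k k) (ℙ.p+p≡0ℙ (parity k))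

even⇒≥2 : ∀ {k} → parity k ≡ 0ℙ → 0 < k → 2 ≤ k
even⇒≥2 {suc (suc _)} _ _ = s≤s (s≤s z≤n)

-- Colorings of P(n,k) from local conditions

is2Packing : Fin 4 → Bool
is2Packing (Fin.suc (Fin.suc _)) = true
is2Packing _                     = false

Compatible₂ : Fin 4 → Fin 4 → Set
Compatible₂ a b = a ≡ b → ¬ T (is2Packing a)

Compatible₂-sym : ∀ {a b} → Compatible₂ a b → Compatible₂ b a
Compatible₂-sym {a} compat refl = compat refl

module _ (n k : ℕ) .{{_ : NonZero n}} where

  open Cyclic n

  -- Each field is named after a path of P(n,k); uuv, say, covers u_i u_{i+1} v_{i+1}.
  record LocalConditions (cu cv : ℕ → Fin 4) : Set where
    field
      uu  : AtShift 1 λ i j → cu i ≢ cu j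
      uv  : ∀ i → i < n → cu i ≢ cv i
      vv  : AtShift k λ i j → cv i ≢ cv j
      uuu : AtShift 2 λ i j → Compatible₂ (cu i) (cu j)
      uuv : AtShift 1 λ i j → Compatible₂ (cu i) (cv j)
      vuu : AtShift 1 λ i j → Compatible₂ (cv i) (cu j)
      uvv : AtShift k λ i j → Compatible₂ (cu i) (cv j)
      vvu : AtShift k λ i j → Compatible₂ (cv i) (cu j)
      vvv : AtShift (k + k) λ i j → Compatible₂ (cv i) (cv j)

  -- The backward steps carry an equation instead of an index addMod n j 1, so that two
  -- consecutive steps can be matched without unifying addMod.
  private
    data Step : Bool × Fin n → Bool × Fin n → Set where
      rim⁺   : ∀ j → Step (false , j) (false , addMod n j 1)
      rim⁻   : ∀ {j m} → addMod n j 1 ≡ m → Step (false , m) (false , j)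
      spoke⁺ : ∀ j → Step (false , j) (true , j)
      spoke⁻ : ∀ j → Step (true , j) (false , j)
      inner⁺ : ∀ j → Step (true , j) (true , addMod n j k)
      inner⁻ : ∀ {j m} → addMod n j k ≡ m → Step (true , m) (true , j)

    adj⇒step : ∀ {x y} → Adj (Petersen n k) x y → Step x y
    adj⇒step ((Fin.zero , j) , inj₁ refl)                   = rim⁺ j
    adj⇒step ((Fin.zero , j) , inj₂ refl)                   = rim⁻ refl
    adj⇒step ((Fin.suc Fin.zero , j) , inj₁ refl)           = spoke⁺ j
    adj⇒step ((Fin.suc Fin.zero , j) , inj₂ refl)           = spoke⁻ j
    adj⇒step ((Fin.suc (Fin.suc Fin.zero) , j) , inj₁ refl) = inner⁺ j
    adj⇒step ((Fin.suc (Fin.suc Fin.zero) , j) , inj₂ refl) = inner⁻ refl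

  Petersen-coloring-from-local : ∀ {cu cv} → 2 ≤ n → k + k ≤ n →
                                 LocalConditions cu cv → Has1122Coloring (Petersen n k)
  Petersen-coloring-from-local {cu} {cv} 2≤n 2k≤n C =
    color , packing₁ _ , packing₁ _ , packing₂ _ _ , packing₂ _ _
    where
    open LocalConditions C

    1≤n : 1 ≤ n
    1≤n = ≤-trans (s≤s z≤n) 2≤n

    k≤n : k ≤ n
    k≤n = ≤-trans (m≤m+n k k) 2k≤n

    color : Bool × Fin n → Fin 4
    color (false , j) = cu (toℕ j)
    color (true  , j) = cv (toℕ j)

    at : ∀ {δ} {R : ℕ → ℕ → Set} → AtShift δ R → δ ≤ n → ∀ j → R (toℕ j) (toℕ (addMod n j δ))
    at cond δ≤n j = cond _ _ (Fin.toℕ<n j) (Fin.toℕ<n _) (addMod-shifted n j δ≤n)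

    at² : ∀ {δ} {R : ℕ → ℕ → Set} → AtShift (δ + δ) R → δ + δ ≤ n →
          ∀ j → R (toℕ j) (toℕ (addMod n (addMod n j δ) δ))
    at² {δ} {R} cond δ+δ≤n j =
      subst (R (toℕ j) ∘ toℕ) (sym (addMod-addMod n j δ δ)) (at cond δ+δ≤n j)

    adjacent : ∀ {x y} → Step x y → color x ≢ color y
    adjacent (rim⁺ j)          = at uu 1≤n j
    adjacent (rim⁻ {j} refl) e = at uu 1≤n j (sym e)
    adjacent (spoke⁺ j)        = uv _ (Fin.toℕ<n j)
    adjacent (spoke⁻ j) e      = uv _ (Fin.toℕ<n j) (sym e)
    adjacent (inner⁺ j)        = at vv k≤n j
    adjacent (inner⁻ {j} refl) e = at vv k≤n j (sym e)

    distance2 : ∀ {x y z} → Step x y → Step y z → x ≢ z → Compatible₂ (color x) (color z)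
    distance2 (rim⁺ j)   (rim⁺ _)   _ = at² uuu 2≤n j
    distance2 (rim⁺ j)   (rim⁻ eq)  x≢z =
      ⊥-elim (x≢z (cong (false ,_) (sym (addMod-injective n 1 1≤n eq))))
    distance2 (rim⁺ j)   (spoke⁺ _) _ = at uuv 1≤n j
    distance2 (rim⁻ refl) (rim⁺ _)  x≢z = ⊥-elim (x≢z refl)
    distance2 (rim⁻ refl) (rim⁻ {j} refl) _ = Compatible₂-sym (at² uuu 2≤n j)
    distance2 (rim⁻ {j} refl) (spoke⁺ _) _ = Compatible₂-sym (at vuu 1≤n j)
    distance2 (spoke⁺ j) (spoke⁻ _) x≢z = ⊥-elim (x≢z refl)
    distance2 (spoke⁺ j) (inner⁺ _) _ = at uvv k≤n j
    distance2 (spoke⁺ _) (inner⁻ {j} refl) _ = Compatible₂-sym (at vvu k≤n j)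
    distance2 (spoke⁻ j) (rim⁺ _)   _ = at vuu 1≤n j
    distance2 (spoke⁻ _) (rim⁻ {j} refl) _ = Compatible₂-sym (at uuv 1≤n j)
    distance2 (spoke⁻ j) (spoke⁺ _) x≢z = ⊥-elim (x≢z refl)
    distance2 (inner⁺ j) (spoke⁻ _) _ = at vvu k≤n j
    distance2 (inner⁺ j) (inner⁺ _) _ = at² vvv 2k≤n j
    distance2 (inner⁺ j) (inner⁻ eq) x≢z =
      ⊥-elim (x≢z (cong (true ,_) (sym (addMod-injective n k k≤n eq))))
    distance2 (inner⁻ refl) (spoke⁻ j) _ = Compatible₂-sym (at uvv k≤n j)
    distance2 (inner⁻ refl) (inner⁺ _) x≢z = ⊥-elim (x≢z refl)
    distance2 (inner⁻ refl) (inner⁻ {j} refl) _ = Compatible₂-sym (at² vvv 2k≤n j)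

    packing₁ : ∀ c → IsPacking (Petersen n k) 1 (Class color c)
    packing₁ c x .x _ _ x≢x (zero , _ , here) = x≢x refl
    packing₁ c x y cx cy _ (suc zero , _ , step a here) = adjacent (adj⇒step a) (trans cx (sym cy))
    packing₁ c x y _ _ _ (suc (suc _) , s≤s () , _)

    packing₂ : ∀ c → T (is2Packing c) → IsPacking (Petersen n k) 2 (Class color c)
    packing₂ c _ x .x _ _ x≢x (zero , _ , here) = x≢x refl
    packing₂ c _ x y cx cy _ (suc zero , _ , step a here) = adjacent (adj⇒step a) (trans cx (sym cy))
    packing₂ c c-2p x y cx cy x≢y (suc (suc zero) , _ , step a (step b here)) =
      distance2 (adj⇒step a) (adj⇒step b) x≢y (trans cx (sym cy)) (subst (T ∘ is2Packing) (sym cx) c-2p)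
    packing₂ c _ x y _ _ _ (suc (suc (suc _)) , s≤s (s≤s ()) , _)

colX colY colA colB : Fin 4
colX = Fin.zero
colY = Fin.suc Fin.zero
colA = Fin.suc (Fin.suc Fin.zero)
colB = Fin.suc (Fin.suc (Fin.suc Fin.zero))

rimColor : Parity → Fin 4
rimColor 0ℙ = colX
rimColor 1ℙ = colY

-- W stands for the independent color that u_i does not use.
data Slot : Set where
  W A B : Slot

slotColor : Slot → Parity → Fin 4
slotColor W p = rimColor (p ⁻¹)
slotColor A _ = colA
slotColor B _ = colB

SlotsAdjacentOK : Slot → Slot → Parity → Parity → Set
SlotsAdjacentOK W W p q = p ≢ q
SlotsAdjacentOK A A _ _ = ⊥
SlotsAdjacentOK B B _ _ = ⊥
SlotsAdjacentOK _ _ _ _ = ⊤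

SlotsDistance2OK : Slot → Slot → Set
SlotsDistance2OK A A = ⊥
SlotsDistance2OK B B = ⊥
SlotsDistance2OK _ _ = ⊤

rimColor-injective : ∀ {p q} → rimColor p ≡ rimColor q → p ≡ q
rimColor-injective {0ℙ} {0ℙ} _ = refl
rimColor-injective {1ℙ} {1ℙ} _ = refl

rimColor-not-2packing : ∀ p → ¬ T (is2Packing (rimColor p))
rimColor-not-2packing 0ℙ ()
rimColor-not-2packing 1ℙ ()

rimColor≢colA : ∀ p → rimColor p ≢ colA
rimColor≢colA 0ℙ ()
rimColor≢colA 1ℙ ()

rimColor≢slotColor : ∀ s p → rimColor p ≢ slotColor s p
rimColor≢slotColor W p e = ℙ.p≢p⁻¹ p (rimColor-injective e)
rimColor≢slotColor A p = rimColor≢colA p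
rimColor≢slotColor B 0ℙ ()
rimColor≢slotColor B 1ℙ ()

slotColor≡colA : ∀ s p → slotColor s p ≡ colA → s ≡ A
slotColor≡colA W p e = ⊥-elim (rimColor≢colA (p ⁻¹) e)
slotColor≡colA A _ _ = refl
slotColor≡colA B _ ()

slotColor-adjacent : ∀ s t p q → SlotsAdjacentOK s t p q → slotColor s p ≢ slotColor t q
slotColor-adjacent W W p q p≢q e = p≢q (ℙ.⁻¹-injective (rimColor-injective e))
slotColor-adjacent W A p _ _ = rimColor≢colA (p ⁻¹)
slotColor-adjacent W B 0ℙ _ _ ()
slotColor-adjacent W B 1ℙ _ _ ()
slotColor-adjacent A W _ q _ e = rimColor≢colA (q ⁻¹) (sym e)
slotColor-adjacent A B _ _ _ ()
slotColor-adjacent B W _ 0ℙ _ ()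
slotColor-adjacent B W _ 1ℙ _ ()
slotColor-adjacent B A _ _ _ ()

slotColor-distance2 : ∀ s t p q → SlotsDistance2OK s t → Compatible₂ (slotColor s p) (slotColor t q)
slotColor-distance2 W _ p _ _ _ = rimColor-not-2packing (p ⁻¹)
slotColor-distance2 A W _ q _ e = ⊥-elim (rimColor≢colA (q ⁻¹) (sym e))
slotColor-distance2 A B _ _ _ ()
slotColor-distance2 B W _ 0ℙ _ ()
slotColor-distance2 B W _ 1ℙ _ ()
slotColor-distance2 B A _ _ _ ()

rimColor-compatible₂ : ∀ p c → Compatible₂ (rimColor p) c
rimColor-compatible₂ p _ _ = rimColor-not-2packing p

distinct⇒SlotsAdjacentOK : ∀ {s t} → s ≢ t → ∀ p q → SlotsAdjacentOK s t p q
distinct⇒SlotsAdjacentOK {W} {W} s≢t = ⊥-elim (s≢t refl)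
distinct⇒SlotsAdjacentOK {W} {A} _ _ _ = tt
distinct⇒SlotsAdjacentOK {W} {B} _ _ _ = tt
distinct⇒SlotsAdjacentOK {A} {W} _ _ _ = tt
distinct⇒SlotsAdjacentOK {A} {A} s≢t = ⊥-elim (s≢t refl)
distinct⇒SlotsAdjacentOK {A} {B} _ _ _ = tt
distinct⇒SlotsAdjacentOK {B} {W} _ _ _ = tt
distinct⇒SlotsAdjacentOK {B} {A} _ _ _ = tt
distinct⇒SlotsAdjacentOK {B} {B} s≢t = ⊥-elim (s≢t refl)

SlotsAdjacentOK-W : ∀ {s} → s ≢ W → ∀ p q → SlotsAdjacentOK W s p q
SlotsAdjacentOK-W {W} s≢W = ⊥-elim (s≢W refl)
SlotsAdjacentOK-W {A} _ _ _ = tt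
SlotsAdjacentOK-W {B} _ _ _ = tt

SlotsAdjacentOK-W′ : ∀ {s} → s ≢ W → ∀ p q → SlotsAdjacentOK s W p q
SlotsAdjacentOK-W′ {W} s≢W = ⊥-elim (s≢W refl)
SlotsAdjacentOK-W′ {A} _ _ _ = tt
SlotsAdjacentOK-W′ {B} _ _ _ = tt

SlotsDistance2OK-sym : ∀ {s t} → SlotsDistance2OK s t → SlotsDistance2OK t s
SlotsDistance2OK-sym {W} {W} _ = tt
SlotsDistance2OK-sym {W} {A} _ = tt
SlotsDistance2OK-sym {W} {B} _ = tt
SlotsDistance2OK-sym {A} {W} _ = tt
SlotsDistance2OK-sym {A} {B} _ = tt
SlotsDistance2OK-sym {B} {W} _ = tt
SlotsDistance2OK-sym {B} {A} _ = tt

SlotsDistance2OK-W : ∀ s → SlotsDistance2OK W s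
SlotsDistance2OK-W W = tt
SlotsDistance2OK-W A = tt
SlotsDistance2OK-W B = tt

SlotsDistance2OK-A : ∀ {s} → s ≢ A → SlotsDistance2OK s A
SlotsDistance2OK-A {W} _ = tt
SlotsDistance2OK-A {A} s≢A = ⊥-elim (s≢A refl)
SlotsDistance2OK-A {B} _ = tt

≡W⇒≢A : ∀ {s} → s ≡ W → s ≢ A
≡W⇒≢A refl ()

≡B⇒≢A : ∀ {s} → s ≡ B → s ≢ A
≡B⇒≢A refl ()

adjacentOK-via : ∀ {s s′ t t′ p q} → s ≡ s′ → t ≡ t′ →
                 SlotsAdjacentOK s′ t′ p q → SlotsAdjacentOK s t p q
adjacentOK-via refl refl ok = ok

distance2OK-via : ∀ {s s′ t t′} → s ≡ s′ → t ≡ t′ → SlotsDistance2OK s′ t′ → SlotsDistance2OK s t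
distance2OK-via refl refl ok = ok

slotOfParity : Parity → Slot
slotOfParity 0ℙ = B
slotOfParity 1ℙ = A

alternating : ℕ → Slot
alternating q = slotOfParity (parity q)

alternating-≢W : ∀ q → alternating q ≢ W
alternating-≢W q with parity q
... | 0ℙ = λ ()
... | 1ℙ = λ ()

alternating-suc : ∀ q → SlotsDistance2OK (alternating q) (alternating (suc q))
alternating-suc q rewrite parity-suc q with parity q
... | 0ℙ = tt
... | 1ℙ = tt

module _ (n k : ℕ) .{{_ : NonZero n}} where

  open Cyclic n

  record InnerSlotting (sl : ℕ → Slot) : Set where
    field
      along-k  : AtShift k λ i j → SlotsAdjacentOK (sl i) (sl j) (parity i) (parity j)
      along-2k : AtShift (k + k) λ i j → SlotsDistance2OK (sl i) (sl j)

  innerColor : (ℕ → Slot) → ℕ → Fin 4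
  innerColor sl i = slotColor (sl i) (parity i)

  module _ {sl : ℕ → Slot} (S : InnerSlotting sl) where

    open InnerSlotting S

    innerColor-adjacent : AtShift k λ i j → innerColor sl i ≢ innerColor sl j
    innerColor-adjacent i j i<n j<n s = slotColor-adjacent _ _ _ _ (along-k i j i<n j<n s)

    innerColor-distance2 : AtShift (k + k) λ i j → Compatible₂ (innerColor sl i) (innerColor sl j)
    innerColor-distance2 i j i<n j<n s = slotColor-distance2 _ _ _ _ (along-2k i j i<n j<n s)

  Petersen-coloring-evenRim : ∀ {sl} → 2 ≤ n → k + k ≤ n → parity n ≡ 0ℙ →
                              InnerSlotting sl → Has1122Coloring (Petersen n k)
  Petersen-coloring-evenRim {sl} 2≤n 2k≤n n-even S = Petersen-coloring-from-local n k 2≤n 2k≤n record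
    { uu  = λ i j _ _ s e → p≢p⊕1 (parity i)
              (trans (rimColor-injective e) (ShiftedBy-parity {δ = 1} {i} n-even s))
    ; uv  = λ i _ → rimColor≢slotColor (sl i) (parity i)
    ; vv  = innerColor-adjacent S
    ; uuu = λ i j _ _ _ → rimColor-compatible₂ (parity i) _
    ; uuv = λ i j _ _ _ → rimColor-compatible₂ (parity i) _
    ; vuu = λ i j _ _ _ → Compatible₂-sym (rimColor-compatible₂ (parity j) _)
    ; uvv = λ i j _ _ _ → rimColor-compatible₂ (parity i) _
    ; vvu = λ i j _ _ _ → Compatible₂-sym (rimColor-compatible₂ (parity j) _)
    ; vvv = innerColor-distance2 S
    }

  oddRimColor : ℕ → Fin 4
  oddRimColor i with suc i ≟ n
  ... | yes _ = colA
  ... | no _  = rimColor (parity i)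

  oddRimColor-last : ∀ {i} → suc i ≡ n → oddRimColor i ≡ colA
  oddRimColor-last {i} i+1≡n with suc i ≟ n
  ... | yes _     = refl
  ... | no i+1≢n  = contradiction i+1≡n i+1≢n

  oddRimColor-other : ∀ {i} → suc i ≢ n → oddRimColor i ≡ rimColor (parity i)
  oddRimColor-other {i} i+1≢n with suc i ≟ n
  ... | yes i+1≡n = contradiction i+1≡n i+1≢n
  ... | no _      = refl

  oddRimColor-cases : ∀ i → suc i ≡ n ⊎ (suc i ≢ n × oddRimColor i ≡ rimColor (parity i))
  oddRimColor-cases i with suc i ≟ n
  ... | yes i+1≡n = inj₁ i+1≡n
  ... | no i+1≢n  = inj₂ (i+1≢n , refl)

  oddRimColor-2packing : ∀ i → T (is2Packing (oddRimColor i)) → suc i ≡ n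
  oddRimColor-2packing i c with suc i ≟ n
  ... | yes i+1≡n = i+1≡n
  ... | no _      = contradiction c (rimColor-not-2packing (parity i))

  -- u_{n-1} has color A, so no v within distance two of it may.
  record CornerFree (sl : ℕ → Slot) : Set where
    field
      v[n-1]   : ∀ i → suc i ≡ n → sl i ≢ A
      v[n-2]   : ∀ i → suc (suc i) ≡ n → sl i ≢ A
      v[0]     : sl 0 ≢ A
      v[k-1]   : ∀ j → suc j ≡ k → sl j ≢ A
      v[n-1-k] : ∀ i → suc (i + k) ≡ n → sl i ≢ A

  Petersen-coloring-oddRim : ∀ {sl} → 3 ≤ n → 0 < k → k + k ≤ n →
                             InnerSlotting sl → CornerFree sl → Has1122Coloring (Petersen n k)
  Petersen-coloring-oddRim {sl} 3≤n k>0 2k≤n S F = Petersen-coloring-from-local n k 2≤n 2k≤n record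
    { uu = uu ; uv = uv ; vv = innerColor-adjacent S
    ; uuu = uuu ; uuv = uuv ; vuu = vuu ; uvv = uvv ; vvu = vvu
    ; vvv = innerColor-distance2 S
    }
    where
    open CornerFree F
    cu cv : ℕ → Fin 4
    cu = oddRimColor
    cv = innerColor sl

    2≤n : 2 ≤ n
    2≤n = ≤-trans (n≤1+n 2) 3≤n

    k<n : k < n
    k<n = <-≤-trans (m<m+n k k>0) 2k≤n

    inner-A : ∀ {i} → cv i ≡ colA → sl i ≡ A
    inner-A {i} = slotColor≡colA (sl i) (parity i)

    rim-last : ∀ {i c} → cu i ≡ c → T (is2Packing c) → suc i ≡ n
    rim-last {i} refl = oddRimColor-2packing i

    rim≢next : ∀ i → rimColor (parity i) ≢ cu (i + 1)
    rim≢next i e with oddRimColor-cases (i + 1)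
    ... | inj₁ i+1-last = rimColor≢colA (parity i) (trans e (oddRimColor-last i+1-last))
    ... | inj₂ (_ , i+1-rim) =
      p≢p⊕1 (parity i) (trans (rimColor-injective (trans e i+1-rim)) (ℙ.+-homo-+ i 1))

    uu : AtShift 1 λ i j → cu i ≢ cu j
    uu i j _ j<n (inj₁ refl) e = rim≢next i (trans (sym (oddRimColor-other i-not-last)) e)
      where
      i-not-last : suc i ≢ n
      i-not-last h = <-irrefl (trans (+-comm i 1) h) j<n
    uu i j i<n _ (inj₂ e) c≡ with wrapped-shift-< {1} {i} {j} i<n e
    ... | s≤s z≤n = rimColor≢colA 0ℙ (trans (sym (oddRimColor-other 1≢n))
                      (trans (sym c≡) (oddRimColor-last (trans (+-comm 1 i) (sym e)))))
      where
      1≢n : 1 ≢ n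
      1≢n h = <-irrefl h 2≤n

    uv : ∀ i → i < n → cu i ≢ cv i
    uv i _ e with oddRimColor-cases i
    ... | inj₁ i-last = v[n-1] i i-last (inner-A (trans (sym e) (oddRimColor-last i-last)))
    ... | inj₂ (_ , i-rim) = rimColor≢slotColor (sl i) (parity i) (trans (sym i-rim) e)

    uuu : AtShift 2 λ i j → Compatible₂ (cu i) (cu j)
    uuu i j _ _ s e c with suc-injective (trans (rim-last refl c) (sym (rim-last (sym e) c)))
    uuu i .i _ _ (inj₁ i≡i+2) _ _ | refl = contradiction (+-cancelˡ-≡ i 0 2 (trans (+-identityʳ i) i≡i+2)) λ ()
    uuu i .i _ _ (inj₂ i+n≡i+2) _ _ | refl = <-irrefl (sym (+-cancelˡ-≡ i n 2 i+n≡i+2)) 3≤n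

    uuv : AtShift 1 λ i j → Compatible₂ (cu i) (cv j)
    uuv i j _ j<n s e c = v[0] (subst (λ m → sl m ≡ A) j≡0 (inner-A (trans (sym e) (oddRimColor-last i-last))))
      where
      i-last : suc i ≡ n
      i-last = rim-last refl c
      j≡0 : j ≡ 0
      j≡0 = suc-injective (ShiftedBy-from-last i-last j<n (s≤s z≤n) s)

    vuu : AtShift 1 λ i j → Compatible₂ (cv i) (cu j)
    vuu i j i<n _ s e c =
      v[n-2] i (trans (cong suc (+-comm 1 i)) (ShiftedBy-to-last j-last i<n (<-≤-trans (s≤s (s≤s z≤n)) 2≤n) s))
                             (inner-A (trans e (oddRimColor-last j-last)))
      where
      j-last : suc j ≡ n
      j-last = rim-last (sym e) c

    uvv : AtShift k λ i j → Compatible₂ (cu i) (cv j)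
    uvv i j _ j<n s e c = v[k-1] j (ShiftedBy-from-last i-last j<n k>0 s)
                            (inner-A (trans (sym e) (oddRimColor-last i-last)))
      where
      i-last : suc i ≡ n
      i-last = rim-last refl c

    vvu : AtShift k λ i j → Compatible₂ (cv i) (cu j)
    vvu i j i<n _ s e c = v[n-1-k] i (ShiftedBy-to-last j-last i<n k<n s)
                            (inner-A (trans e (oddRimColor-last j-last)))
      where
      j-last : suc j ≡ n
      j-last = rim-last (sym e) c

-- Even n

cycleAWBW : ℕ → Slot
cycleAWBW 0 = A
cycleAWBW 1 = W
cycleAWBW 2 = B
cycleAWBW 3 = W
cycleAWBW (suc (suc (suc (suc r)))) = cycleAWBW r

cycleAWB : ℕ → Slot
cycleAWB 0 = A
cycleAWB 1 = W
cycleAWB 2 = B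
cycleAWB (suc (suc (suc r))) = cycleAWB r

cycleAWBW-adjacent : ∀ r → cycleAWBW r ≢ cycleAWBW (suc r)
cycleAWBW-adjacent 0 ()
cycleAWBW-adjacent 1 ()
cycleAWBW-adjacent 2 ()
cycleAWBW-adjacent 3 ()
cycleAWBW-adjacent (suc (suc (suc (suc r)))) = cycleAWBW-adjacent r

cycleAWBW-distance2 : ∀ r → SlotsDistance2OK (cycleAWBW r) (cycleAWBW (suc (suc r)))
cycleAWBW-distance2 0 = tt
cycleAWBW-distance2 1 = tt
cycleAWBW-distance2 2 = tt
cycleAWBW-distance2 3 = tt
cycleAWBW-distance2 (suc (suc (suc (suc r)))) = cycleAWBW-distance2 r

cycleAWB-adjacent : ∀ r → cycleAWB r ≢ cycleAWB (suc r)
cycleAWB-adjacent 0 ()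
cycleAWB-adjacent 1 ()
cycleAWB-adjacent 2 ()
cycleAWB-adjacent (suc (suc (suc r))) = cycleAWB-adjacent r

cycleAWB-distance2 : ∀ r → SlotsDistance2OK (cycleAWB r) (cycleAWB (suc (suc r)))
cycleAWB-distance2 0 = tt
cycleAWB-distance2 1 = tt
cycleAWB-distance2 2 = tt
cycleAWB-distance2 (suc (suc (suc r))) = cycleAWB-distance2 r

cycleAWBW-periodic : ∀ a m → cycleAWBW (4 * a + m) ≡ cycleAWBW m
cycleAWBW-periodic zero    m = refl
cycleAWBW-periodic (suc a) m = trans (cong cycleAWBW (shift a m)) (cycleAWBW-periodic a m)
  where
  shift : ∀ a m → 4 * suc a + m ≡ 4 + (4 * a + m)
  shift = solve-∀

cycleAWB-periodic : ∀ b m → cycleAWB (3 * b + m) ≡ cycleAWB m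
cycleAWB-periodic zero    m = refl
cycleAWB-periodic (suc b) m = trans (cong cycleAWB (shift b m)) (cycleAWB-periodic b m)
  where
  shift : ∀ b m → 3 * suc b + m ≡ 3 + (3 * b + m)
  shift = solve-∀

blockPattern : ℕ → ℕ → Slot
blockPattern a p = if does (p <? 4 * a) then cycleAWBW p else cycleAWB (p ∸ 4 * a)

blockPattern-low : ∀ {a p} → p < 4 * a → blockPattern a p ≡ cycleAWBW p
blockPattern-low {a} {p} p<4a rewrite dec-true (p <? 4 * a) p<4a = refl

blockPattern-high : ∀ {a p} → 4 * a ≤ p → blockPattern a p ≡ cycleAWB (p ∸ 4 * a)
blockPattern-high {a} {p} 4a≤p rewrite dec-false (p <? 4 * a) (≤⇒≯ 4a≤p) = refl

cycleAWBW-before-block-end : ∀ a p → suc p ≡ 4 * a → cycleAWBW p ≡ W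
cycleAWBW-before-block-end (suc a) p e =
  trans (cong cycleAWBW (suc-injective (trans e (shift a)))) (cycleAWBW-periodic a 3)
  where
  shift : ∀ a → 4 * suc a ≡ suc (4 * a + 3)
  shift = solve-∀

cycleAWBW-two-before-block-end : ∀ a p → suc (suc p) ≡ 4 * a → cycleAWBW p ≡ B
cycleAWBW-two-before-block-end (suc a) p e =
  trans (cong cycleAWBW (suc-injective (suc-injective (trans e (shift a))))) (cycleAWBW-periodic a 2)
  where
  shift : ∀ a → 4 * suc a ≡ suc (suc (4 * a + 2))
  shift = solve-∀

blockPattern-at-4a : ∀ a → blockPattern a (4 * a) ≡ A
blockPattern-at-4a a = trans (blockPattern-high {a} ≤-refl) (cong cycleAWB (n∸n≡0 (4 * a)))

blockPattern-adjacent : ∀ a p → blockPattern a p ≢ blockPattern a (suc p)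
blockPattern-adjacent a p = by-cases (suc p <? 4 * a) (p <? 4 * a)
  where
  by-cases : Dec (suc p < 4 * a) → Dec (p < 4 * a) → blockPattern a p ≢ blockPattern a (suc p)
  by-cases (yes p+1<4a) _ = subst₂ _≢_ (sym (blockPattern-low {a} (<-trans (n<1+n p) p+1<4a)))
    (sym (blockPattern-low {a} p+1<4a)) (cycleAWBW-adjacent p)
  by-cases (no p+1≮4a) (no p≮4a) = subst₂ _≢_ (sym (blockPattern-high {a} (≮⇒≥ p≮4a)))
    (sym (trans (blockPattern-high {a} (≮⇒≥ p+1≮4a)) (cong cycleAWB (+-∸-assoc 1 (≮⇒≥ p≮4a)))))
    (cycleAWB-adjacent (p ∸ 4 * a))
  by-cases (no p+1≮4a) (yes p<4a) = subst₂ _≢_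
    (sym (trans (blockPattern-low {a} p<4a) (cycleAWBW-before-block-end a p p+1≡4a)))
    (sym (trans (cong (blockPattern a) p+1≡4a) (blockPattern-at-4a a))) (λ ())
    where
    p+1≡4a : suc p ≡ 4 * a
    p+1≡4a = ≤-antisym p<4a (≮⇒≥ p+1≮4a)

blockPattern-distance2 : ∀ a p → SlotsDistance2OK (blockPattern a p) (blockPattern a (suc (suc p)))
blockPattern-distance2 a p = by-cases (suc (suc p) <? 4 * a) (suc p <? 4 * a) (p <? 4 * a)
  where
  by-cases : Dec (suc (suc p) < 4 * a) → Dec (suc p < 4 * a) → Dec (p < 4 * a) →
             SlotsDistance2OK (blockPattern a p) (blockPattern a (suc (suc p)))
  by-cases (yes p+2<4a) _ _ =
    subst₂ SlotsDistance2OK (sym (blockPattern-low {a} (<-trans (n<1+n p) (<-trans (n<1+n (suc p)) p+2<4a))))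
      (sym (blockPattern-low {a} p+2<4a)) (cycleAWBW-distance2 p)
  by-cases (no p+2≮4a) _ (no p≮4a) =
    subst₂ SlotsDistance2OK (sym (blockPattern-high {a} (≮⇒≥ p≮4a)))
      (sym (trans (blockPattern-high {a} (≮⇒≥ p+2≮4a)) (cong cycleAWB (+-∸-assoc 2 (≮⇒≥ p≮4a)))))
      (cycleAWB-distance2 (p ∸ 4 * a))
  by-cases (no p+2≮4a) (yes p+1<4a) (yes p<4a) =
    subst₂ SlotsDistance2OK
      (sym (trans (blockPattern-low {a} p<4a) (cycleAWBW-two-before-block-end a p p+2≡4a)))
      (sym (trans (cong (blockPattern a) p+2≡4a) (blockPattern-at-4a a))) tt
    where
    p+2≡4a : suc (suc p) ≡ 4 * a
    p+2≡4a = ≤-antisym p+1<4a (≮⇒≥ p+2≮4a)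
  by-cases (no _) (no p+1≮4a) (yes p<4a) =
    subst (λ s → SlotsDistance2OK s (blockPattern a (suc (suc p))))
      (sym (trans (blockPattern-low {a} p<4a) (cycleAWBW-before-block-end a p p+1≡4a)))
      (SlotsDistance2OK-W (blockPattern a (suc (suc p))))
    where
    p+1≡4a : suc p ≡ 4 * a
    p+1≡4a = ≤-antisym p<4a (≮⇒≥ p+1≮4a)

blockPattern-0 : ∀ a → blockPattern a 0 ≡ A
blockPattern-0 zero    = refl
blockPattern-0 (suc a) = blockPattern-low {suc a} (s≤s z≤n)

blockPattern-1 : ∀ a → blockPattern a 1 ≡ W
blockPattern-1 zero    = refl
blockPattern-1 (suc a) = blockPattern-low {suc a} (≤-trans (s≤s (s≤s z≤n)) (*-monoʳ-≤ 4 (s≤s (z≤n {a}))))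

blockPattern-last : ∀ a b p → suc p ≡ 4 * a + 3 * b → blockPattern a p ≢ A
blockPattern-last (suc a) zero p e rewrite +-identityʳ (4 * suc a) =
  subst (_≢ A) (sym (trans (blockPattern-low {suc a} (subst (p <_) e (n<1+n p)))
                           (cycleAWBW-before-block-end (suc a) p e))) (λ ())
blockPattern-last a (suc b) p e =
  subst (_≢ A) (sym (trans (blockPattern-high {a} (subst (4 * a ≤_) (sym p≡) (m≤m+n _ _)))
                           (trans (cong cycleAWB (trans (cong (_∸ 4 * a) p≡) (m+n∸m≡n (4 * a) _)))
                                  (cycleAWB-periodic b 2)))) (λ ())
  where
  shift : ∀ a b → 4 * a + 3 * suc b ≡ suc (4 * a + (3 * b + 2))
  shift = solve-∀
  p≡ : p ≡ 4 * a + (3 * b + 2)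
  p≡ = suc-injective (trans e (shift a b))

blockPattern-second-last : ∀ a b p → suc (suc p) ≡ 4 * a + 3 * b → blockPattern a p ≢ A
blockPattern-second-last (suc a) zero p e rewrite +-identityʳ (4 * suc a) =
  subst (_≢ A) (sym (trans (blockPattern-low {suc a} (subst (p <_) e (<-≤-trans (n<1+n p) (n≤1+n (suc p)))))
                           (cycleAWBW-two-before-block-end (suc a) p e))) (λ ())
blockPattern-second-last a (suc b) p e =
  subst (_≢ A) (sym (trans (blockPattern-high {a} (subst (4 * a ≤_) (sym p≡) (m≤m+n _ _)))
                           (trans (cong cycleAWB (trans (cong (_∸ 4 * a) p≡) (m+n∸m≡n (4 * a) _)))
                                  (cycleAWB-periodic b 1)))) (λ ())
  where
  shift : ∀ a b → 4 * a + 3 * suc b ≡ suc (suc (4 * a + (3 * b + 1)))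
  shift = solve-∀
  p≡ : p ≡ 4 * a + (3 * b + 1)
  p≡ = suc-injective (suc-injective (trans e (shift a b)))

module _ (L a b : ℕ) .{{_ : NonZero L}} (4a+3b≡L : 4 * a + 3 * b ≡ L) where

  open Cyclic L

  blockPattern-cyclic-adjacent : AtShift 1 λ p q → blockPattern a p ≢ blockPattern a q
  blockPattern-cyclic-adjacent p q _ _ (inj₁ refl) rewrite +-comm p 1 = blockPattern-adjacent a p
  blockPattern-cyclic-adjacent p q p<L _ (inj₂ e) with wrapped-shift-< {1} {p} {q} p<L e
  ... | s≤s z≤n = subst (blockPattern a p ≢_) (sym (blockPattern-0 a))
    (blockPattern-last a b p (trans (trans (+-comm 1 p) (sym e)) (sym 4a+3b≡L)))

  blockPattern-cyclic-distance2 : AtShift 2 λ p q → SlotsDistance2OK (blockPattern a p) (blockPattern a q)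
  blockPattern-cyclic-distance2 p q _ _ (inj₁ refl) rewrite +-comm p 2 = blockPattern-distance2 a p
  blockPattern-cyclic-distance2 p q p<L _ (inj₂ e) with wrapped-shift-< {2} {p} {q} p<L e
  ... | s≤s z≤n = subst (SlotsDistance2OK (blockPattern a p)) (sym (blockPattern-0 a))
    (SlotsDistance2OK-A (blockPattern-second-last a b p (trans (trans (+-comm 2 p) (sym e)) (sym 4a+3b≡L))))
  ... | s≤s (s≤s z≤n) = subst (SlotsDistance2OK (blockPattern a p)) (sym (blockPattern-1 a))
    (SlotsDistance2OK-sym (SlotsDistance2OK-W (blockPattern a p)))

four-three-decomposition : ∀ L → 3 ≤ L → L ≢ 5 → ∃[ a ] ∃[ b ] 4 * a + 3 * b ≡ L
four-three-decomposition 1 (s≤s ()) _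
four-three-decomposition 2 (s≤s (s≤s ())) _
four-three-decomposition 3 _ _ = 0 , 1 , refl
four-three-decomposition 4 _ _ = 1 , 0 , refl
four-three-decomposition 5 _ L≢5 = contradiction refl L≢5
four-three-decomposition 6 _ _ = 0 , 2 , refl
four-three-decomposition 7 _ _ = 1 , 1 , refl
four-three-decomposition 8 _ _ = 2 , 0 , refl
four-three-decomposition 9 _ _ = 0 , 3 , refl
four-three-decomposition (suc (suc (suc (suc (suc (suc (suc (suc (suc (suc m)))))))))) _ _
  with four-three-decomposition (suc (suc (suc (suc (suc (suc m)))))) (s≤s (s≤s (s≤s z≤n))) (λ ())
... | a , b , e = suc a , b , trans (shift a b) (cong (4 +_) e)
  where
  shift : ∀ a b → 4 * suc a + 3 * b ≡ 4 + (4 * a + 3 * b)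
  shift = solve-∀

module _ (n k : ℕ) .{{_ : NonZero n}} where

  private
    module ℕn = Cyclic n

  record CycleCoordinate (L : ℕ) .{{_ : NonZero L}} (pos : ℕ → ℕ) : Set where
    private module ℕL = Cyclic L
    field
      pos<L : ∀ i → pos i < L
      step₁ : ℕn.AtShift k λ i j → ℕL.ShiftedBy 1 (pos i) (pos j) ⊎ ℕL.ShiftedBy 1 (pos j) (pos i)
      step₂ : ℕn.AtShift (k + k) λ i j → ℕL.ShiftedBy 2 (pos i) (pos j) ⊎ ℕL.ShiftedBy 2 (pos j) (pos i)

  blockPattern-slotting : ∀ {L a b pos} .{{_ : NonZero L}} → 4 * a + 3 * b ≡ L →
                          CycleCoordinate L pos → InnerSlotting n k (blockPattern a ∘ pos)
  blockPattern-slotting {L} {a} {b} {pos} L≡ C = record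
    { along-k = λ i j i<n j<n s → distinct⇒SlotsAdjacentOK (adjacent i j (step₁ i j i<n j<n s)) _ _
    ; along-2k = λ i j i<n j<n s → distance2 i j (step₂ i j i<n j<n s)
    }
    where
    open CycleCoordinate C
    module ℕL = Cyclic L

    adjacent : ∀ i j → ℕL.ShiftedBy 1 (pos i) (pos j) ⊎ ℕL.ShiftedBy 1 (pos j) (pos i) →
               blockPattern a (pos i) ≢ blockPattern a (pos j)
    adjacent i j (inj₁ s) = blockPattern-cyclic-adjacent L a b L≡ _ _ (pos<L i) (pos<L j) s
    adjacent i j (inj₂ s) = ≢-sym (blockPattern-cyclic-adjacent L a b L≡ _ _ (pos<L j) (pos<L i) s)

    distance2 : ∀ i j → ℕL.ShiftedBy 2 (pos i) (pos j) ⊎ ℕL.ShiftedBy 2 (pos j) (pos i) →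
                SlotsDistance2OK (blockPattern a (pos i)) (blockPattern a (pos j))
    distance2 i j (inj₁ s) = blockPattern-cyclic-distance2 L a b L≡ _ _ (pos<L i) (pos<L j) s
    distance2 i j (inj₂ s) =
      SlotsDistance2OK-sym (blockPattern-cyclic-distance2 L a b L≡ _ _ (pos<L j) (pos<L i) s)

  private
    g : ℕ
    g = gcd k n

    instance
      g≢0 : NonZero g
      g≢0 = ≢-nonZero (gcd[m,n]≢0 k n (inj₂ (≢-nonZero⁻¹ n)))

    g∣k : g ∣ k
    g∣k = gcd[m,n]∣m k n

    g∣n : g ∣ n
    g∣n = gcd[m,n]∣n k n

  cycleLength : ℕ
  cycleLength = n / g

  private
    L k′ : ℕ
    L = cycleLength
    k′ = k / g

    L*g≡n : L * g ≡ n
    L*g≡n = m/n*n≡m g∣n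

    k′*g≡k : k′ * g ≡ k
    k′*g≡k = m/n*n≡m g∣k

  instance
    cycleLength≢0 : NonZero cycleLength
    cycleLength≢0 = ≢-nonZero λ L≡0 → ≢-nonZero⁻¹ n (trans (sym L*g≡n) (cong (_* g) L≡0))

  3≤cycleLength : 0 < k → k + k < n → 3 ≤ cycleLength
  3≤cycleLength k>0 2k<n = ≤-trans (s≤s (+-mono-≤ k′≥1 k′≥1)) 2k′<L
    where
    k′≥1 : 1 ≤ k′
    k′≥1 = n≢0⇒n>0 λ k′≡0 → <⇒≢ k>0 (sym (trans (sym k′*g≡k) (cong (_* g) k′≡0)))
    2k′<L : k′ + k′ < L
    2k′<L = *-cancelʳ-< g (k′ + k′) L
      (subst₂ _<_ (trans (cong₂ _+_ (sym k′*g≡k) (sym k′*g≡k)) (sym (*-distribʳ-+ g k′ k′)))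
                  (sym L*g≡n) 2k<n)

  cycleLength≢5 : ¬ 5 ∣ n → cycleLength ≢ 5
  cycleLength≢5 5∤n L≡5 = 5∤n (divides g (trans (sym L*g≡n) (trans (cong (_* g) L≡5) (*-comm 5 g))))

  private
    module ℕL = Cyclic L

    quotient-shift : ∀ {δ i j} → g ∣ δ → ℕn.ShiftedBy δ i j → ∃[ t ] i / g + δ / g ≡ j / g + t * L
    quotient-shift {δ} {i} {j} g∣δ (inj₁ refl) =
      0 , trans (sym (+-distrib-/-∣ʳ i g∣δ)) (sym (+-identityʳ _))
    quotient-shift {δ} {i} {j} g∣δ (inj₂ e) = 1 , (begin
      i / g + δ / g    ≡⟨ sym (+-distrib-/-∣ʳ i g∣δ) ⟩
      (i + δ) / g      ≡⟨ cong (_/ g) (sym e) ⟩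
      (j + n) / g      ≡⟨ +-distrib-/-∣ʳ j g∣n ⟩
      j / g + L        ≡⟨ cong (j / g +_) (sym (*-identityˡ L)) ⟩
      j / g + 1 * L    ∎)
      where open ≡-Reasoning

    module Coordinate (x : ℕ) where

      pos : ℕ → ℕ
      pos i = (x * (i / g)) % L

      pos<L : ∀ i → pos i < L
      pos<L i = m%n<n _ L

      shift-forward : ∀ {δ c Y i j} → c ≤ L → g ∣ δ → x * (δ / g) ≡ c + Y * L →
             ℕn.ShiftedBy δ i j → ℕL.ShiftedBy c (pos i) (pos j)
      shift-forward {δ} {c} {Y} {i} {j} c≤L g∣δ xd≡ s with quotient-shift g∣δ s
      ... | t , ud≡ = subst (ℕL.ShiftedBy c (pos i))
        (sym (trans (ℕL.*-shift-% {x} {δ / g} {c} {Y} {i / g} {j / g} {t} xd≡ ud≡)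
                    (sym (ℕL.%-add-mod (x * (i / g)) c))))
        (ℕL.%-shifted (pos<L i) c≤L)

      shift-backward : ∀ {δ c Y i j} → c ≤ L → g ∣ δ → x * (δ / g) + c ≡ Y * L →
              ℕn.ShiftedBy δ i j → ℕL.ShiftedBy c (pos j) (pos i)
      shift-backward {δ} {c} {Y} {i} {j} c≤L g∣δ xd≡ s with quotient-shift g∣δ s
      ... | t , ud≡ = subst (ℕL.ShiftedBy c (pos j))
        (sym (trans (ℕL.*-shift-%′ {x} {δ / g} {c} {Y} {i / g} {j / g} {t} xd≡ ud≡)
                    (sym (ℕL.%-add-mod (x * (j / g)) c))))
        (ℕL.%-shifted (pos<L j) c≤L)

  gcd-cycleCoordinate : 0 < k → k + k < n → ∃[ pos ] CycleCoordinate cycleLength pos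
  gcd-cycleCoordinate k>0 2k<n with coprime-Bézout (coprime-/gcd k n)
  ... | Bézout.+- x y 1+yL≡xk′ = pos , record
    { pos<L = pos<L
    ; step₁ = λ _ _ _ _ s → inj₁ (shift-forward {Y = y} 1≤L g∣k (sym 1+yL≡xk′) s)
    ; step₂ = λ _ _ _ _ s → inj₁ (shift-forward {Y = y + y} 2≤L (∣m∣n⇒∣m+n g∣k g∣k) x[2k′]≡ s)
    }
    where
    open Coordinate x
    x[2k′]≡ : x * ((k + k) / g) ≡ 2 + (y + y) * L
    x[2k′]≡ = begin
      x * ((k + k) / g)          ≡⟨ cong (x *_) (+-distrib-/-∣ʳ k g∣k) ⟩
      x * (k′ + k′)              ≡⟨ *-distribˡ-+ x k′ k′ ⟩
      x * k′ + x * k′            ≡⟨ cong₂ _+_ (sym 1+yL≡xk′) (sym 1+yL≡xk′) ⟩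
      (1 + y * L) + (1 + y * L)  ≡⟨ regroup y L ⟩
      2 + (y + y) * L            ∎
      where
      open ≡-Reasoning
      regroup : ∀ y L → (1 + y * L) + (1 + y * L) ≡ 2 + (y + y) * L
      regroup = solve-∀
    2≤L : 2 ≤ L
    2≤L = ≤-trans (n≤1+n 2) (3≤cycleLength k>0 2k<n)
    1≤L : 1 ≤ L
    1≤L = ≤-trans (n≤1+n 1) 2≤L
  ... | Bézout.-+ x y 1+xk′≡yL = pos , record
    { pos<L = pos<L
    ; step₁ = λ _ _ _ _ s → inj₂ (shift-backward {Y = y} 1≤L g∣k (trans (+-comm (x * k′) 1) 1+xk′≡yL) s)
    ; step₂ = λ _ _ _ _ s → inj₂ (shift-backward {Y = y + y} 2≤L (∣m∣n⇒∣m+n g∣k g∣k) x[2k′]≡ s)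
    }
    where
    open Coordinate x
    x[2k′]≡ : x * ((k + k) / g) + 2 ≡ (y + y) * L
    x[2k′]≡ = begin
      x * ((k + k) / g) + 2          ≡⟨ cong (λ w → x * w + 2) (+-distrib-/-∣ʳ k g∣k) ⟩
      x * (k′ + k′) + 2              ≡⟨ regroup x k′ ⟩
      (1 + x * k′) + (1 + x * k′)    ≡⟨ cong₂ _+_ 1+xk′≡yL 1+xk′≡yL ⟩
      y * L + y * L                  ≡⟨ sym (*-distribʳ-+ L y y) ⟩
      (y + y) * L                    ∎
      where
      open ≡-Reasoning
      regroup : ∀ x k → x * (k + k) + 2 ≡ (1 + x * k) + (1 + x * k)
      regroup = solve-∀
    2≤L : 2 ≤ L
    2≤L = ≤-trans (n≤1+n 2) (3≤cycleLength k>0 2k<n)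
    1≤L : 1 ≤ L
    1≤L = ≤-trans (n≤1+n 1) 2≤L

  Petersen-coloring-even : parity n ≡ 0ℙ → 0 < k → k + k < n → ¬ 5 ∣ n → Has1122Coloring (Petersen n k)
  Petersen-coloring-even n-even k>0 2k<n 5∤n
    with four-three-decomposition cycleLength (3≤cycleLength k>0 2k<n) (cycleLength≢5 5∤n)
       | gcd-cycleCoordinate k>0 2k<n
  ... | a , b , L≡ | pos , C =
    Petersen-coloring-evenRim n k 2≤n (<⇒≤ 2k<n) n-even (blockPattern-slotting {a = a} {b} L≡ C)
    where
    2≤n : 2 ≤ n
    2≤n = ≤-trans (+-mono-≤ k>0 k>0) (<⇒≤ 2k<n)

-- Odd n

m≮n⇒m+o≮n+o : ∀ {m n o} → ¬ m < n → ¬ m + o < n + o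
m≮n⇒m+o≮n+o {m} {n} {o} m≮n l = m≮n (+-cancelʳ-< o m n l)

module OddKLoose (n k : ℕ) .{{_ : NonZero n}} (k-odd : parity k ≡ 1ℙ) (2k+3≤n : 3 + (k + k) ≤ n) where

  open Cyclic n

  private
    d : ℕ
    d = n ∸ (k + k)

    d+2k≡n : d + (k + k) ≡ n
    d+2k≡n = m∸n+n≡m (≤-trans (m≤n+m (k + k) 3) 2k+3≤n)

    3≤d : 3 ≤ d
    3≤d = +-cancelʳ-≤ (k + k) 3 d (subst (3 + (k + k) ≤_) (sym d+2k≡n) 2k+3≤n)

    instance
      d≢0 : NonZero d
      d≢0 = >-nonZero (≤-trans (s≤s z≤n) 3≤d)

    2k<n : k + k < n
    2k<n = ≤-trans (s≤s (m≤n+m (k + k) 2)) 2k+3≤n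

    k>0 : 0 < k
    k>0 = n≢0⇒n>0 λ { refl → contradiction k-odd λ () }

    k<n : k < n
    k<n = <-≤-trans (m<m+n k k>0) (<⇒≤ 2k<n)

  -- The v_i with i + k ≥ n alternate between B and A in runs of length d, counted back from v_{n-1}.
  slot : ℕ → Slot
  slot i = if does (i + k <? n) then W else alternating ((n ∸ suc i) / d)

  slot-free : ∀ {i} → i + k < n → slot i ≡ W
  slot-free {i} lt rewrite dec-true (i + k <? n) lt = refl

  slot-wrap : ∀ {i} → ¬ i + k < n → slot i ≡ alternating ((n ∸ suc i) / d)
  slot-wrap {i} ge rewrite dec-false (i + k <? n) ge = refl

  private
    wraps : ∀ {i j} → j + n ≡ i + k → ¬ i + k < n
    wraps {i} {j} e lt = <⇒≱ lt (subst (n ≤_) e (m≤n+m n j))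

    wrapped-free : ∀ {i j} → i < n → j + n ≡ i + k → j + k < n
    wrapped-free i<n e = <-≤-trans (+-monoˡ-< _ (wrapped-shift-< i<n e)) (<⇒≤ 2k<n)

    run-step : ∀ {i j} → i < n → j < n → j + n ≡ i + (k + k) → n ∸ suc j ≡ (n ∸ suc i) + d
    run-step {i} {j} i<n j<n e = +-cancelʳ-≡ (suc j + n) _ _ (trans lhs (sym rhs))
      where
      lhs : (n ∸ suc j) + (suc j + n) ≡ n + n
      lhs = trans (sym (+-assoc (n ∸ suc j) (suc j) n)) (cong (_+ n) (m∸n+n≡m j<n))
      regroup : ∀ a d i m → a + d + suc (i + m) ≡ (a + suc i) + (d + m)
      regroup = solve-∀
      rhs : (n ∸ suc i) + d + (suc j + n) ≡ n + n
      rhs = trans (cong (λ z → (n ∸ suc i) + d + suc z) e)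
              (trans (regroup (n ∸ suc i) d i (k + k)) (cong₂ _+_ (m∸n+n≡m i<n) d+2k≡n))

  along-k : AtShift k λ i j → SlotsAdjacentOK (slot i) (slot j) (parity i) (parity j)
  along-k i .(i + k) _ j<n (inj₁ refl) with i + k + k <? n
  ... | yes l rewrite slot-free {i} j<n | slot-free {i + k} l = parity-+-odd i k k-odd
  ... | no l rewrite slot-free {i} j<n | slot-wrap {i + k} l =
    SlotsAdjacentOK-W (alternating-≢W ((n ∸ suc (i + k)) / d)) _ _
  along-k i j i<n _ (inj₂ e) rewrite slot-wrap {i} (wraps e) | slot-free {j} (wrapped-free i<n e) =
    SlotsAdjacentOK-W′ (alternating-≢W ((n ∸ suc i) / d)) _ _

  along-2k : AtShift (k + k) λ i j → SlotsDistance2OK (slot i) (slot j)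
  along-2k i .(i + (k + k)) _ j<n (inj₁ refl) rewrite slot-free {i} (≤-<-trans (+-monoʳ-≤ i (m≤m+n k k)) j<n) =
    SlotsDistance2OK-W (slot (i + (k + k)))
  along-2k i j i<n j<n (inj₂ e) with i + k <? n | j + k <? n
  ... | yes i-free | _ rewrite slot-free i-free = SlotsDistance2OK-W (slot j)
  ... | no _ | yes j-free rewrite slot-free j-free = SlotsDistance2OK-sym (SlotsDistance2OK-W (slot i))
  ... | no i-wraps | no j-wraps
    rewrite slot-wrap i-wraps | slot-wrap j-wraps | run-step i<n j<n e
          | m/n≡1+[m∸n]/n {(n ∸ suc i) + d} {d} (m≤n+m d _) | m+n∸n≡m (n ∸ suc i) d =
    alternating-suc ((n ∸ suc i) / d)

  inner-slotting : InnerSlotting n k slot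
  inner-slotting = record { along-k = along-k ; along-2k = along-2k }

  corner-free : CornerFree n k slot
  corner-free = record
    { v[n-1]   = λ i i+1≡n → near-end i 0 (trans (+-identityʳ (suc i)) i+1≡n) (≤-trans (s≤s z≤n) 3≤d)
                               (last-wraps i+1≡n)
    ; v[n-2]   = λ i i+2≡n → case-free i (near-end i 1 (trans (+-comm (suc i) 1) i+2≡n) (≤-trans (s≤s (s≤s z≤n)) 3≤d))
    ; v[0]     = free-≢A k<n
    ; v[k-1]   = λ j j+1≡k → free-≢A (<-≤-trans (+-monoˡ-< k (subst (j <_) j+1≡k (n<1+n j))) (<⇒≤ 2k<n))
    ; v[n-1-k] = λ i i+k+1≡n → free-≢A (subst (i + k <_) i+k+1≡n (n<1+n (i + k)))
    }
    where
    last-wraps : ∀ {i} → suc i ≡ n → ¬ i + k < n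
    last-wraps {i} i+1≡n l = <⇒≱ l (subst (_≤ i + k) (trans (+-comm i 1) i+1≡n) (+-monoʳ-≤ i k>0))

    free-≢A : ∀ {i} → i + k < n → slot i ≢ A
    free-≢A l = ≡W⇒≢A (slot-free l)

    near-end : ∀ i r → suc i + r ≡ n → r < d → ¬ i + k < n → slot i ≢ A
    near-end i r i+1+r≡n r<d wraps = ≡B⇒≢A (trans (slot-wrap wraps) (cong alternating q≡0))
      where
      q≡0 : (n ∸ suc i) / d ≡ 0
      q≡0 = trans (cong (λ m → (m ∸ suc i) / d) (sym i+1+r≡n))
                  (trans (cong (_/ d) (m+n∸m≡n (suc i) r)) (m<n⇒m/n≡0 r<d))

    case-free : ∀ i → (¬ i + k < n → slot i ≢ A) → slot i ≢ A
    case-free i wrapped with i + k <? n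
    ... | yes l = free-≢A l
    ... | no l  = wrapped l

module Rim2k+1 (n k : ℕ) (n≡2k+1 : n ≡ suc (k + k)) where

  i+k<n⇒i≤k : ∀ {i} → i + k < n → i ≤ k
  i+k<n⇒i≤k {i} l = +-cancelʳ-≤ k i k (≤-pred (subst (i + k <_) n≡2k+1 l))

  i<n⇒i≤2k : ∀ {i} → i < n → i ≤ k + k
  i<n⇒i≤2k i<n = ≤-pred (subst (_ <_) n≡2k+1 i<n)

  wrapped-by-k : ∀ {i j} → j + n ≡ i + k → suc (j + k) ≡ i
  wrapped-by-k {i} {j} e = +-cancelʳ-≡ k (suc (j + k)) i (trans (regroup j k) (trans (cong (j +_) (sym n≡2k+1)) e))
    where
    regroup : ∀ j k → suc (j + k) + k ≡ j + suc (k + k)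
    regroup = solve-∀

  wrapped-by-2k : ∀ {i j} → j + n ≡ i + (k + k) → suc j ≡ i
  wrapped-by-2k {i} {j} e =
    +-cancelʳ-≡ (k + k) (suc j) i (trans (sym (+-suc j (k + k))) (trans (cong (j +_) (sym n≡2k+1)) e))

  shifted-by-2k⇒first : ∀ {i} → i + (k + k) < n → i ≡ 0
  shifted-by-2k⇒first {i} l = n≤0⇒n≡0 (+-cancelʳ-≤ (k + k) i 0 (≤-pred (subst (suc (i + (k + k)) ≤_) n≡2k+1 l)))

module OddKTight (n k : ℕ) .{{_ : NonZero n}} (k-odd : parity k ≡ 1ℙ) (n≡2k+1 : n ≡ suc (k + k)) where

  open Cyclic n
  open Rim2k+1 n k n≡2k+1

  slot : ℕ → Slot
  slot i = if does (i <? k) then (if does (suc (suc i) ≟ k) then A else W)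
           else if does (i ≟ k) then W
           else if does (suc i ≟ k + k) then W
           else if does (suc i <? k + k) then alternating (suc (i ∸ k))
           else B

  private
    k>0 : 0 < k
    k>0 = n≢0⇒n>0 λ { refl → contradiction k-odd λ () }

    k≢2 : k ≢ 2
    k≢2 refl = contradiction k-odd λ ()

    k<2k : k < k + k
    k<2k = subst (_< k + k) (+-identityʳ k) (+-monoʳ-< k k>0)

  slot-low : ∀ {i} → i < k → suc (suc i) ≢ k → slot i ≡ W
  slot-low {i} i<k ne rewrite dec-true (i <? k) i<k | dec-false (suc (suc i) ≟ k) ne = refl

  slot-k-2 : ∀ {i} → suc (suc i) ≡ k → slot i ≡ A
  slot-k-2 {i} e rewrite dec-true (i <? k) (subst (i <_) e (n≤1+n (suc i))) | dec-true (suc (suc i) ≟ k) e = refl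

  slot-k : slot k ≡ W
  slot-k rewrite dec-false (k <? k) (n≮n k) | dec-true (k ≟ k) refl = refl

  slot-2k-1 : ∀ {i} → k < i → suc i ≡ k + k → slot i ≡ W
  slot-2k-1 {i} k<i e rewrite dec-false (i <? k) (<⇒≯ k<i) | dec-false (i ≟ k) (>⇒≢ k<i)
                            | dec-true (suc i ≟ k + k) e = refl

  slot-mid : ∀ {i} → k < i → suc i < k + k → slot i ≡ alternating (suc (i ∸ k))
  slot-mid {i} k<i i+1<2k rewrite dec-false (i <? k) (<⇒≯ k<i) | dec-false (i ≟ k) (>⇒≢ k<i)
                                | dec-false (suc i ≟ k + k) (<⇒≢ i+1<2k) | dec-true (suc i <? k + k) i+1<2k = refl

  slot-2k : slot (k + k) ≡ B
  slot-2k rewrite dec-false (k + k <? k) (≤⇒≯ (m≤m+n k k)) | dec-false (k + k ≟ k) (>⇒≢ k<2k)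
                | dec-false (suc (k + k) ≟ k + k) (λ e → <-irrefl (sym e) (n<1+n (k + k)))
                | dec-false (suc (k + k) <? k + k) (λ l → <-irrefl refl (<-trans (n<1+n (k + k)) l)) = refl

  private
    odd-below : ∀ {i} → suc (suc i) ≡ k → alternating (suc i) ≡ B
    odd-below {i} i+2≡k = cong slotOfParity (trans (parity-suc i) (cong _⁻¹ (trans (cong parity i+2≡k) k-odd)))

    k<i+k : ∀ {i} → i ≢ 0 → k < i + k
    k<i+k i≢0 = +-monoˡ-< k {0} (n≢0⇒n>0 i≢0)

    k-2≢0 : ∀ {i} → suc (suc i) ≡ k → i ≢ 0
    k-2≢0 e refl = k≢2 (sym e)

    k-2+k+1<2k : ∀ {i} → suc (suc i) ≡ k → suc (i + k) < k + k
    k-2+k+1<2k {i} e = subst (suc (suc (i + k)) ≤_) (cong (_+ k) e) ≤-refl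

    before-k-low : ∀ {j} → suc j ≡ k → slot j ≡ W
    before-k-low {j} j+1≡k = slot-low (subst (j <_) j+1≡k (n<1+n j)) (λ h → <-irrefl (trans j+1≡k (sym h)) (n<1+n (suc j)))

  along-k : AtShift k λ i j → SlotsAdjacentOK (slot i) (slot j) (parity i) (parity j)
  along-k i .(i + k) _ j<n (inj₁ refl) with <-cmp i k
  ... | tri> _ _ k<i = contradiction (i+k<n⇒i≤k j<n) (<⇒≱ k<i)
  ... | tri≈ _ refl _ rewrite slot-k | slot-2k = tt
  ... | tri< i<k _ _ with suc (suc i) ≟ k | i ≟ 0 | suc i ≟ k
  ...   | yes i+2≡k | _ | _ rewrite slot-k-2 i+2≡k | slot-mid {i + k} (k<i+k (k-2≢0 i+2≡k)) (k-2+k+1<2k i+2≡k)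
                                  | m+n∸n≡m i k | odd-below i+2≡k = tt
  ...   | no i+2≢k | yes refl | _ rewrite slot-low i<k i+2≢k | slot-k = parity-+-odd 0 k k-odd
  ...   | no i+2≢k | no i≢0 | yes i+1≡k rewrite slot-low i<k i+2≢k
                                        | slot-2k-1 {i + k} (k<i+k i≢0) (cong (_+ k) i+1≡k) =
    parity-+-odd i k k-odd
  ...   | no i+2≢k | no i≢0 | no i+1≢k rewrite slot-low i<k i+2≢k
                                        | slot-mid {i + k} (k<i+k i≢0)
                                                           (<⇒≤ (+-monoˡ-< k (≤∧≢⇒< (≤∧≢⇒< i<k i+1≢k) i+2≢k))) =
    SlotsAdjacentOK-W (alternating-≢W (suc (i + k ∸ k))) _ _
  along-k i j i<n _ (inj₂ e) with wrapped-by-k {i} {j} e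
  ... | refl with <-cmp (suc (suc (j + k))) (k + k)
  ...   | tri< i+1<2k _ _ rewrite slot-mid {suc (j + k)} (s≤s (m≤n+m k j)) i+1<2k
                                | slot-low {j} (<-trans (n<1+n j) (<-trans (n<1+n (suc j)) (+-cancelʳ-< k (suc (suc j)) k i+1<2k)))
                                               (<⇒≢ (+-cancelʳ-< k (suc (suc j)) k i+1<2k)) =
    SlotsAdjacentOK-W′ (alternating-≢W (suc (suc (j + k) ∸ k))) _ _
  ...   | tri≈ _ i+1≡2k _ rewrite slot-2k-1 {suc (j + k)} (s≤s (m≤n+m k j)) i+1≡2k
                                | slot-k-2 {j} (+-cancelʳ-≡ k (suc (suc j)) k i+1≡2k) = tt
  ...   | tri> _ _ i+1>2k rewrite ≤-antisym (i<n⇒i≤2k i<n) (≤-pred i+1>2k) | slot-2k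
                                | before-k-low {j} (+-cancelʳ-≡ k (suc j) k (≤-antisym (i<n⇒i≤2k i<n) (≤-pred i+1>2k))) = tt

  along-2k : AtShift (k + k) λ i j → SlotsDistance2OK (slot i) (slot j)
  along-2k i .(i + (k + k)) _ j<n (inj₁ refl) =
    subst (λ s → SlotsDistance2OK s (slot (i + (k + k))))
      (sym (trans (cong slot (shifted-by-2k⇒first j<n)) (slot-low {0} k>0 (λ e → k≢2 (sym e)))))
      (SlotsDistance2OK-W (slot (i + (k + k))))
  along-2k i j i<n _ (inj₂ e) with wrapped-by-2k {i} {j} e
  ... | refl with <-cmp j k
  ...   | tri< j<k _ _ with <-cmp (suc j) k
  ...     | tri< j+1<k _ _ with suc (suc (suc j)) ≟ k
  ...       | yes j+3≡k rewrite slot-k-2 j+3≡k | slot-low j<k (λ h → <-irrefl (trans h (sym j+3≡k)) (n<1+n _)) = tt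
  ...       | no j+3≢k rewrite slot-low j+1<k j+3≢k = SlotsDistance2OK-W (slot j)
  along-2k _ j _ _ _ | refl | tri< _ _ _ | tri≈ _ j+1≡k _ rewrite j+1≡k | slot-k = SlotsDistance2OK-W (slot j)
  along-2k _ j _ _ _ | refl | tri< j<k _ _ | tri> _ _ j+1>k = contradiction j<k (<⇒≱ j+1>k)
  along-2k _ j _ _ _ | refl | tri≈ _ refl _ rewrite slot-k = SlotsDistance2OK-sym (SlotsDistance2OK-W (slot (suc k)))
  along-2k _ j i<n _ _ | refl | tri> _ _ k<j with <-cmp (suc (suc j)) (k + k)
  ... | tri< j+2<2k _ _ rewrite slot-mid {suc j} (<-trans k<j (n<1+n j)) j+2<2k
                              | slot-mid {j} k<j (<-trans (n<1+n (suc j)) j+2<2k) | +-∸-assoc 1 (<⇒≤ k<j) =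
    SlotsDistance2OK-sym (alternating-suc (suc (j ∸ k)))
  ... | tri≈ _ j+2≡2k _ rewrite slot-2k-1 {suc j} (<-trans k<j (n<1+n j)) j+2≡2k = SlotsDistance2OK-W (slot j)
  ... | tri> _ _ j+2>2k rewrite slot-2k-1 {j} k<j (≤-antisym (i<n⇒i≤2k i<n) (≤-pred j+2>2k)) =
    SlotsDistance2OK-sym (SlotsDistance2OK-W (slot (suc j)))

  inner-slotting : InnerSlotting n k slot
  inner-slotting = record { along-k = along-k ; along-2k = along-2k }

  corner-free : CornerFree n k slot
  corner-free = record
    { v[n-1]   = λ i i+1≡n → ≡B⇒≢A (trans (cong slot (suc-injective (trans i+1≡n n≡2k+1))) slot-2k)
    ; v[n-2]   = λ i i+2≡n → second-last i (suc-injective (trans i+2≡n n≡2k+1))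
    ; v[0]     = ≡W⇒≢A (slot-low {0} k>0 (λ e → k≢2 (sym e)))
    ; v[k-1]   = λ j j+1≡k → ≡W⇒≢A (before-k-low j+1≡k)
    ; v[n-1-k] = λ i i+k+1≡n → ≡W⇒≢A (trans (cong slot (+-cancelʳ-≡ k i k (suc-injective (trans i+k+1≡n n≡2k+1)))) slot-k)
    }
    where
    second-last : ∀ i → suc i ≡ k + k → slot i ≢ A
    second-last i i+1≡2k with <-cmp k i
    ... | tri< k<i _ _ = ≡W⇒≢A (slot-2k-1 k<i i+1≡2k)
    ... | tri≈ _ refl _ = ≡W⇒≢A slot-k
    ... | tri> _ _ i<k = contradiction (subst (_≤ k) i+1≡2k i<k) (<⇒≱ k<2k)

module EvenKTight (n k : ℕ) .{{_ : NonZero n}} (n-odd : parity n ≡ 1ℙ) (k-even : parity k ≡ 0ℙ)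
                      (n≡2k+1 : n ≡ suc (k + k)) (4≤k : 4 ≤ k) where

  open Cyclic n
  open Rim2k+1 n k n≡2k+1

  slot : ℕ → Slot
  slot i = if does (i <? k) then (if does (suc (suc i) ≟ k) then A else W)
           else if does (suc (suc i) ≟ k + k) then W
           else if does (suc i ≟ k + k) then B
           else if does (i <? k + k) then alternating (i ∸ k)
           else W

  private
    k>0 : 0 < k
    k>0 = ≤-trans (s≤s z≤n) 4≤k

    2≢k : 2 ≢ k
    2≢k e = <⇒≱ (subst (_< 4) e (s≤s (s≤s (s≤s z≤n)))) 4≤k

    k+3<2k : suc (suc (suc k)) < k + k
    k+3<2k = +-monoˡ-≤ k 4≤k

  slot-low : ∀ {i} → i < k → suc (suc i) ≢ k → slot i ≡ W
  slot-low {i} i<k ne rewrite dec-true (i <? k) i<k | dec-false (suc (suc i) ≟ k) ne = refl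

  slot-k-2 : ∀ {i} → suc (suc i) ≡ k → slot i ≡ A
  slot-k-2 {i} e rewrite dec-true (i <? k) (subst (i <_) e (n≤1+n (suc i))) | dec-true (suc (suc i) ≟ k) e = refl

  slot-2k-2 : ∀ {i} → ¬ i < k → suc (suc i) ≡ k + k → slot i ≡ W
  slot-2k-2 {i} i≮k e rewrite dec-false (i <? k) i≮k | dec-true (suc (suc i) ≟ k + k) e = refl

  slot-2k-1 : ∀ {i} → ¬ i < k → suc i ≡ k + k → slot i ≡ B
  slot-2k-1 {i} i≮k e rewrite dec-false (i <? k) i≮k
                            | dec-false (suc (suc i) ≟ k + k) (λ h → <-irrefl (trans e (sym h)) (n<1+n (suc i)))
                            | dec-true (suc i ≟ k + k) e = refl

  slot-mid : ∀ {i} → ¬ i < k → suc (suc i) < k + k → slot i ≡ alternating (i ∸ k)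
  slot-mid {i} i≮k l rewrite dec-false (i <? k) i≮k | dec-false (suc (suc i) ≟ k + k) (<⇒≢ l)
                           | dec-false (suc i ≟ k + k) (<⇒≢ (<-trans (n<1+n (suc i)) l))
                           | dec-true (i <? k + k) (<-trans (n<1+n i) (<-trans (n<1+n (suc i)) l)) = refl

  slot-2k : slot (k + k) ≡ W
  slot-2k rewrite dec-false (k + k <? k) (λ l → <⇒≱ l (m≤m+n k k))
                | dec-false (suc (suc (k + k)) ≟ k + k) (λ h → <-irrefl (sym h) (≤-trans (n<1+n _) (n≤1+n _)))
                | dec-false (suc (k + k) ≟ k + k) (λ h → <-irrefl (sym h) (n<1+n _))
                | dec-false (k + k <? k + k) (<-irrefl refl) = refl

  slot-k : slot k ≡ B
  slot-k = trans (slot-mid (<-irrefl refl) (<-trans (n<1+n _) k+3<2k)) (cong alternating (n∸n≡0 k))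

  private
    before-k-low : ∀ {j} → suc j ≡ k → slot j ≡ W
    before-k-low {j} j+1≡k = slot-low (subst (j <_) j+1≡k (n<1+n j)) (λ h → <-irrefl (trans j+1≡k (sym h)) (n<1+n (suc j)))

    wrapped-parity′ : ∀ {i j} → j + n ≡ i + k → parity i ≢ parity j
    wrapped-parity′ {i} {j} = wrapped-parity {n} {k} {i} {j} n-odd k-even

  along-k : AtShift k λ i j → SlotsAdjacentOK (slot i) (slot j) (parity i) (parity j)
  along-k i .(i + k) _ j<n (inj₁ refl) with <-cmp i k
  ... | tri> _ _ k<i = contradiction (i+k<n⇒i≤k j<n) (<⇒≱ k<i)
  ... | tri≈ _ refl _ = adjacentOK-via slot-k slot-2k tt
  ... | tri< i<k _ _ with suc (suc i) ≟ k | suc i ≟ k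
  ...   | yes i+2≡k | _ = adjacentOK-via (slot-k-2 i+2≡k) (slot-2k-2 {i + k} (m+n≮n i k) (cong (_+ k) i+2≡k)) tt
  ...   | no i+2≢k | yes i+1≡k = adjacentOK-via (slot-low i<k i+2≢k) (slot-2k-1 {i + k} (m+n≮n i k) (cong (_+ k) i+1≡k)) tt
  ...   | no i+2≢k | no i+1≢k = adjacentOK-via (slot-low i<k i+2≢k)
          (slot-mid {i + k} (m+n≮n i k) (+-monoˡ-< k (≤∧≢⇒< (≤∧≢⇒< i<k i+1≢k) i+2≢k)))
          (SlotsAdjacentOK-W (alternating-≢W (i + k ∸ k)) _ _)
  along-k i j i<n _ (inj₂ e) with wrapped-by-k {i} {j} e
  ... | refl with <-cmp (suc (suc (suc (j + k)))) (k + k)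
  ...   | tri< i+2<2k _ _ = adjacentOK-via (slot-mid {suc (j + k)} (m+n≮n (suc j) k) i+2<2k)
          (slot-low (<-trans (≤-trans (n<1+n j) (n≤1+n _)) (<-trans (n<1+n (suc (suc j))) j+3<k)) (<⇒≢ (<-trans (n<1+n _) j+3<k)))
          (SlotsAdjacentOK-W′ (alternating-≢W (suc (j + k) ∸ k)) _ _)
    where
    j+3<k : suc (suc (suc j)) < k
    j+3<k = +-cancelʳ-< k (suc (suc (suc j))) k i+2<2k
  ...   | tri≈ _ i+2≡2k _ = adjacentOK-via (slot-2k-2 {suc (j + k)} (m+n≮n (suc j) k) i+2≡2k)
          (slot-low (subst (j <_) j+3≡k (≤-trans (n<1+n j) (≤-trans (n≤1+n _) (n≤1+n _))))
                    (λ h → <-irrefl (trans h (sym j+3≡k)) (n<1+n _)))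
          (wrapped-parity′ e)
    where
    j+3≡k : suc (suc (suc j)) ≡ k
    j+3≡k = +-cancelʳ-≡ k (suc (suc (suc j))) k i+2≡2k
  ...   | tri> _ _ i+2>2k with suc (suc (j + k)) ≟ k + k
  ...     | yes i+1≡2k = adjacentOK-via (slot-2k-1 {suc (j + k)} (m+n≮n (suc j) k) i+1≡2k)
                           (slot-k-2 {j} (+-cancelʳ-≡ k (suc (suc j)) k i+1≡2k)) tt
  ...     | no i+1≢2k = adjacentOK-via (trans (cong slot i≡2k) slot-2k)
                          (before-k-low (+-cancelʳ-≡ k (suc j) k i≡2k)) (wrapped-parity′ e)
    where
    i≡2k : suc (j + k) ≡ k + k
    i≡2k = ≤-antisym (i<n⇒i≤2k i<n) (≤-pred (≤∧≢⇒< (≤-pred i+2>2k) (≢-sym i+1≢2k)))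

  along-2k : AtShift (k + k) λ i j → SlotsDistance2OK (slot i) (slot j)
  along-2k i .(i + (k + k)) _ j<n (inj₁ refl) =
    distance2OK-via (trans (cong slot (shifted-by-2k⇒first j<n)) (slot-low k>0 2≢k)) refl
      (SlotsDistance2OK-W (slot (i + (k + k))))
  along-2k i j i<n _ (inj₂ e) with wrapped-by-2k {i} {j} e
  ... | refl with <-cmp j k
  ...   | tri< j<k _ _ with <-cmp (suc j) k
  ...     | tri< j+1<k _ _ with suc (suc (suc j)) ≟ k
  ...       | yes j+3≡k = distance2OK-via (slot-k-2 j+3≡k) (slot-low j<k (λ h → <-irrefl (trans h (sym j+3≡k)) (n<1+n _))) tt
  ...       | no j+3≢k = distance2OK-via (slot-low j+1<k j+3≢k) refl (SlotsDistance2OK-W (slot j))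
  along-2k _ j _ _ _ | refl | tri< j<k _ _ | tri≈ _ j+1≡k _ =
    distance2OK-via (trans (cong slot j+1≡k) slot-k) (slot-low j<k (λ h → <-irrefl (trans j+1≡k (sym h)) (n<1+n _))) tt
  along-2k _ j _ _ _ | refl | tri< j<k _ _ | tri> _ _ j+1>k = contradiction j<k (<⇒≱ j+1>k)
  along-2k _ j _ _ _ | refl | tri≈ _ refl _ =
    distance2OK-via (trans (slot-mid {suc k} (λ l → <-irrefl refl (<-trans (n<1+n k) l)) k+3<2k)
                           (cong alternating (trans (+-∸-assoc 1 (≤-refl {k})) (cong suc (n∸n≡0 k)))))
                    slot-k tt
  along-2k _ j i<n _ _ | refl | tri> _ _ k<j with <-cmp (suc (suc (suc j))) (k + k)
  ... | tri< j+3<2k _ _ =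
    distance2OK-via (trans (slot-mid {suc j} (λ l → <⇒≱ l (<⇒≤ (<-trans k<j (n<1+n j)))) j+3<2k)
                           (cong alternating (+-∸-assoc 1 (<⇒≤ k<j))))
                    (slot-mid {j} (λ l → <⇒≱ l (<⇒≤ k<j)) (<-trans (n<1+n _) j+3<2k))
                    (SlotsDistance2OK-sym (alternating-suc (j ∸ k)))
  ... | tri≈ _ j+3≡2k _ =
    distance2OK-via (slot-2k-2 {suc j} (λ l → <⇒≱ l (<⇒≤ (<-trans k<j (n<1+n j)))) j+3≡2k) refl (SlotsDistance2OK-W (slot j))
  ... | tri> _ _ j+3>2k with suc (suc j) ≟ k + k
  ...   | yes j+2≡2k = distance2OK-via (slot-2k-1 {suc j} (λ l → <⇒≱ l (<⇒≤ (<-trans k<j (n<1+n j)))) j+2≡2k)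
                         (slot-2k-2 {j} (λ l → <⇒≱ l (<⇒≤ k<j)) j+2≡2k) tt
  ...   | no j+2≢2k = distance2OK-via (trans (cong slot j+1≡2k) slot-2k) refl (SlotsDistance2OK-W (slot j))
    where
    j+1≡2k : suc j ≡ k + k
    j+1≡2k = ≤-antisym (i<n⇒i≤2k i<n) (≤-pred (≤∧≢⇒< (≤-pred j+3>2k) (≢-sym j+2≢2k)))

  inner-slotting : InnerSlotting n k slot
  inner-slotting = record { along-k = along-k ; along-2k = along-2k }

  corner-free : CornerFree n k slot
  corner-free = record
    { v[n-1]   = λ i i+1≡n → ≡W⇒≢A (trans (cong slot (suc-injective (trans i+1≡n n≡2k+1))) slot-2k)
    ; v[n-2]   = λ i i+2≡n → ≡B⇒≢A (slot-2k-1 (λ l → <⇒≱ k<2k (subst (_≤ k) (suc-injective (trans i+2≡n n≡2k+1)) l))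
                                                  (suc-injective (trans i+2≡n n≡2k+1)))
    ; v[0]     = ≡W⇒≢A (slot-low k>0 2≢k)
    ; v[k-1]   = λ j j+1≡k → ≡W⇒≢A (before-k-low j+1≡k)
    ; v[n-1-k] = λ i i+k+1≡n → ≡B⇒≢A (trans (cong slot (+-cancelʳ-≡ k i k (suc-injective (trans i+k+1≡n n≡2k+1)))) slot-k)
    }
    where
    k<2k : k < k + k
    k<2k = subst (_< k + k) (+-identityʳ k) (+-monoʳ-< k k>0)

cycleWBWA : ℕ → Slot
cycleWBWA 0 = W
cycleWBWA 1 = B
cycleWBWA 2 = W
cycleWBWA 3 = A
cycleWBWA (suc (suc (suc (suc r)))) = cycleWBWA r

cycleBBAA : ℕ → Slot
cycleBBAA 0 = B
cycleBBAA 1 = B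
cycleBBAA 2 = A
cycleBBAA 3 = A
cycleBBAA (suc (suc (suc (suc r)))) = cycleBBAA r

cycleWBWA-adjacent : ∀ r → cycleWBWA (suc r) ≢ cycleWBWA r
cycleWBWA-adjacent 0 ()
cycleWBWA-adjacent 1 ()
cycleWBWA-adjacent 2 ()
cycleWBWA-adjacent 3 ()
cycleWBWA-adjacent (suc (suc (suc (suc r)))) = cycleWBWA-adjacent r

cycleWBWA-distance2 : ∀ r → SlotsDistance2OK (cycleWBWA (suc (suc r))) (cycleWBWA r)
cycleWBWA-distance2 0 = tt
cycleWBWA-distance2 1 = tt
cycleWBWA-distance2 2 = tt
cycleWBWA-distance2 3 = tt
cycleWBWA-distance2 (suc (suc (suc (suc r)))) = cycleWBWA-distance2 r

cycleBBAA-WBWA-adjacent : ∀ r → cycleBBAA (suc r) ≢ cycleWBWA r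
cycleBBAA-WBWA-adjacent 0 ()
cycleBBAA-WBWA-adjacent 1 ()
cycleBBAA-WBWA-adjacent 2 ()
cycleBBAA-WBWA-adjacent 3 ()
cycleBBAA-WBWA-adjacent (suc (suc (suc (suc r)))) = cycleBBAA-WBWA-adjacent r

cycleBBAA-WBWA-distance2 : ∀ r → SlotsDistance2OK (cycleBBAA (suc (suc r))) (cycleWBWA r)
cycleBBAA-WBWA-distance2 0 = tt
cycleBBAA-WBWA-distance2 1 = tt
cycleBBAA-WBWA-distance2 2 = tt
cycleBBAA-WBWA-distance2 3 = tt
cycleBBAA-WBWA-distance2 (suc (suc (suc (suc r)))) = cycleBBAA-WBWA-distance2 r

cycleBBAA-≢W : ∀ r → cycleBBAA r ≢ W
cycleBBAA-≢W 0 ()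
cycleBBAA-≢W 1 ()
cycleBBAA-≢W 2 ()
cycleBBAA-≢W 3 ()
cycleBBAA-≢W (suc (suc (suc (suc r)))) = cycleBBAA-≢W r

module EvenKWide (n k : ℕ) .{{_ : NonZero n}} (n-odd : parity n ≡ 1ℙ) (k-even : parity k ≡ 0ℙ)
                     (k>0 : 0 < k) (3k<n : k + (k + k) < n) where

  open Cyclic n

  private
    instance
      k≢0 : NonZero k
      k≢0 = >-nonZero k>0

    block : ℕ → ℕ
    block i = (n ∸ suc i) / k

  slot : ℕ → Slot
  slot i = if does (i <? k) then W else if does (i <? k + k) then cycleBBAA (block i) else cycleWBWA (block i)

  slot-low : ∀ {i} → i < k → slot i ≡ W
  slot-low {i} i<k rewrite dec-true (i <? k) i<k = refl

  slot-mid : ∀ {i} → ¬ i < k → i < k + k → slot i ≡ cycleBBAA (block i)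
  slot-mid {i} i≮k i<2k rewrite dec-false (i <? k) i≮k | dec-true (i <? k + k) i<2k = refl

  slot-high : ∀ {i} → ¬ i < k + k → slot i ≡ cycleWBWA (block i)
  slot-high {i} i≮2k rewrite dec-false (i <? k + k) i≮2k
                           | dec-false (i <? k) (λ l → i≮2k (<-≤-trans l (m≤m+n k k))) = refl

  private
    block-step : ∀ {i j} → j < n → j ≡ i + k → block i ≡ suc (block j)
    block-step {i} {j} j<n refl = begin
      (n ∸ suc i) / k                ≡⟨ cong (_/ k) (sym (m∸n+n≡m {n ∸ suc i} {k} k≤)) ⟩
      (n ∸ suc i ∸ k + k) / k        ≡⟨ m/n≡1+[m∸n]/n (m≤n+m k _) ⟩
      suc ((n ∸ suc i ∸ k + k ∸ k) / k) ≡⟨ cong (λ m → suc (m / k)) (trans (m+n∸n≡m _ k) (∸-+-assoc n (suc i) k)) ⟩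
      suc ((n ∸ suc (i + k)) / k)    ∎
      where
      open ≡-Reasoning
      k≤ : k ≤ n ∸ suc i
      k≤ = m+n≤o⇒m≤o∸n k (subst (_≤ n) (+-comm (suc i) k) j<n)

    block-step² : ∀ {i} → i + (k + k) < n → block i ≡ suc (suc (block (i + (k + k))))
    block-step² {i} l = trans (block-step {i} {i + k} (≤-<-trans (+-monoʳ-≤ i (m≤m+n k k)) l) refl)
                          (cong suc (block-step {i + k} {i + (k + k)} l (sym (+-assoc i k k))))

    block-last : ∀ {i} → n ≤ i + k → block i ≡ 0
    block-last {i} n≤i+k = m<n⇒m/n≡0 (m<n+o⇒m∸n<o n (suc i) (s≤s n≤i+k))

    wrapping-high : ∀ {i} → n ≤ i + k → ¬ i < k + k
    wrapping-high {i} n≤i+k i<2k = <-irrefl refl (<-≤-trans 3k<n (≤-trans n≤i+k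
      (subst (i + k ≤_) (+-comm (k + k) k) (+-monoˡ-≤ k (<⇒≤ i<2k)))))

    slot-wrapping : ∀ {i} → n ≤ i + k → slot i ≡ W
    slot-wrapping n≤i+k = trans (slot-high (wrapping-high n≤i+k)) (cong cycleWBWA (block-last n≤i+k))

  along-k : AtShift k λ i j → SlotsAdjacentOK (slot i) (slot j) (parity i) (parity j)
  along-k i .(i + k) _ j<n (inj₁ refl) with i <? k | i <? k + k
  ... | yes i<k | _ = adjacentOK-via (slot-low i<k) (slot-mid (m+n≮n i k) (+-monoˡ-< k i<k))
                        (SlotsAdjacentOK-W (cycleBBAA-≢W (block (i + k))) _ _)
  ... | no i≮k | yes i<2k = adjacentOK-via (trans (slot-mid i≮k i<2k) (cong cycleBBAA (block-step j<n refl)))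
                              (slot-high {i + k} (m≮n⇒m+o≮n+o i≮k))
                              (distinct⇒SlotsAdjacentOK (cycleBBAA-WBWA-adjacent (block (i + k))) _ _)
  ... | no i≮k | no i≮2k = adjacentOK-via (trans (slot-high i≮2k) (cong cycleWBWA (block-step j<n refl)))
                             (slot-high {i + k} (m≮n⇒m+o≮n+o i≮k))
                             (distinct⇒SlotsAdjacentOK (cycleWBWA-adjacent (block (i + k))) _ _)
  along-k i j i<n _ (inj₂ e) =
    adjacentOK-via (slot-wrapping (subst (n ≤_) e (m≤n+m n j))) (slot-low (wrapped-shift-< i<n e))
      (wrapped-parity {n} {k} {i} {j} n-odd k-even e)

  along-2k : AtShift (k + k) λ i j → SlotsDistance2OK (slot i) (slot j)
  along-2k i .(i + (k + k)) _ j<n (inj₁ refl) with i <? k | i <? k + k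
  ... | yes i<k | _ = distance2OK-via (slot-low i<k) refl (SlotsDistance2OK-W (slot (i + (k + k))))
  ... | no i≮k | yes i<2k = distance2OK-via (trans (slot-mid i≮k i<2k) (cong cycleBBAA (block-step² j<n)))
                              (slot-high {i + (k + k)} (λ l → <⇒≱ l (m≤n+m (k + k) i)))
                              (cycleBBAA-WBWA-distance2 (block (i + (k + k))))
  ... | no _ | no i≮2k = distance2OK-via (trans (slot-high i≮2k) (cong cycleWBWA (block-step² j<n)))
                           (slot-high {i + (k + k)} (λ l → <⇒≱ l (m≤n+m (k + k) i)))
                           (cycleWBWA-distance2 (block (i + (k + k))))
  along-2k i j _ _ (inj₂ e) with j <? k
  ... | yes j<k = distance2OK-via refl (slot-low j<k) (SlotsDistance2OK-sym (SlotsDistance2OK-W (slot i)))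
  ... | no j≮k = distance2OK-via (slot-wrapping n≤i+k) refl (SlotsDistance2OK-W (slot j))
    where
    regroup : ∀ i k → i + (k + k) ≡ k + (i + k)
    regroup = solve-∀
    n≤i+k : n ≤ i + k
    n≤i+k = +-cancelˡ-≤ k n (i + k) (subst (k + n ≤_) (trans e (regroup i k)) (+-monoˡ-≤ n (≮⇒≥ j≮k)))

  inner-slotting : InnerSlotting n k slot
  inner-slotting = record { along-k = along-k ; along-2k = along-2k }

  corner-free : CornerFree n k slot
  corner-free = record
    { v[n-1]   = λ i i+1≡n → ≡W⇒≢A (slot-wrapping (subst (_≤ i + k) (trans (+-comm i 1) i+1≡n) (+-monoʳ-≤ i k>0)))
    ; v[n-2]   = λ i i+2≡n → ≡W⇒≢A (slot-wrapping (subst (_≤ i + k) (trans (+-comm i 2) i+2≡n) (+-monoʳ-≤ i 2≤k)))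
    ; v[0]     = ≡W⇒≢A (slot-low k>0)
    ; v[k-1]   = λ j j+1≡k → ≡W⇒≢A (slot-low (subst (j <_) j+1≡k (n<1+n j)))
    ; v[n-1-k] = λ i i+k+1≡n → ≡B⇒≢A (trans (slot-high (i≮2k i+k+1≡n)) (cong cycleWBWA (block-1 i+k+1≡n)))
    }
    where
    2≤k : 2 ≤ k
    2≤k = even⇒≥2 k-even k>0
    i≮2k : ∀ {i} → suc (i + k) ≡ n → ¬ i < k + k
    i≮2k {i} e l = <⇒≱ 3k<n (subst (_≤ k + (k + k)) e (subst (suc (i + k) ≤_) (+-comm (k + k) k) (+-monoˡ-≤ k l)))
    block-1 : ∀ {i} → suc (i + k) ≡ n → block i ≡ 1
    block-1 {i} e = trans (cong (λ m → (m ∸ suc i) / k) (sym e))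
                      (trans (cong (_/ k) (m+n∸m≡n (suc i) k)) (n/n≡1 k))

module EvenKMedium (n k : ℕ) .{{_ : NonZero n}} (n-odd : parity n ≡ 1ℙ) (k-even : parity k ≡ 0ℙ)
                       (2k+3≤n : 3 + (k + k) ≤ n) (n<3k : n < k + (k + k)) where

  open Cyclic n

  private
    d : ℕ
    d = n ∸ (k + k)

    d+2k≡n : d + (k + k) ≡ n
    d+2k≡n = m∸n+n≡m (≤-trans (m≤n+m (k + k) 3) 2k+3≤n)

    3≤d : 3 ≤ d
    3≤d = +-cancelʳ-≤ (k + k) 3 d (subst (3 + (k + k) ≤_) (sym d+2k≡n) 2k+3≤n)

    instance
      d≢0 : NonZero d
      d≢0 = >-nonZero (≤-trans (s≤s z≤n) 3≤d)

  slot : ℕ → Slot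
  slot i = if does (i <? k) then W else if does (i <? k + k) then alternating ((i ∸ k) / d) else W

  slot-low : ∀ {i} → i < k → slot i ≡ W
  slot-low {i} i<k rewrite dec-true (i <? k) i<k = refl

  slot-mid : ∀ {i} → ¬ i < k → i < k + k → slot i ≡ alternating ((i ∸ k) / d)
  slot-mid {i} i≮k i<2k rewrite dec-false (i <? k) i≮k | dec-true (i <? k + k) i<2k = refl

  slot-high : ∀ {i} → ¬ i < k + k → slot i ≡ W
  slot-high {i} i≮2k rewrite dec-false (i <? k + k) i≮2k
                           | dec-false (i <? k) (λ l → i≮2k (<-≤-trans l (m≤m+n k k))) = refl

  private
    n≤ : ∀ {m} → n ≤ m → ¬ m ≤ 2 + (k + k)
    n≤ n≤m m≤ = <⇒≱ 2k+3≤n (≤-trans n≤m m≤)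

  along-k : AtShift k λ i j → SlotsAdjacentOK (slot i) (slot j) (parity i) (parity j)
  along-k i .(i + k) _ j<n (inj₁ refl) with i <? k | i <? k + k
  ... | yes i<k | _ = adjacentOK-via (slot-low i<k) (slot-mid (m+n≮n i k) (+-monoˡ-< k i<k))
                        (SlotsAdjacentOK-W (alternating-≢W ((i + k ∸ k) / d)) _ _)
  ... | no i≮k | yes i<2k = adjacentOK-via (slot-mid i≮k i<2k) (slot-high {i + k} (m≮n⇒m+o≮n+o i≮k))
                              (SlotsAdjacentOK-W′ (alternating-≢W ((i ∸ k) / d)) _ _)
  ... | no _ | no i≮2k = contradiction (≤-trans (≤-reflexive (+-comm k (k + k)))
                           (≤-trans (+-monoˡ-≤ k (≮⇒≥ i≮2k)) (<⇒≤ j<n))) (<⇒≱ n<3k)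
  along-k i j i<n _ (inj₂ e) with i <? k + k
  ... | yes i<2k = adjacentOK-via (slot-mid i≮k i<2k) (slot-low j<k)
                     (SlotsAdjacentOK-W′ (alternating-≢W ((i ∸ k) / d)) _ _)
    where
    j<k : j < k
    j<k = wrapped-shift-< i<n e
    i≮k : ¬ i < k
    i≮k l = <⇒≱ (+-monoˡ-< k l) (subst (k + k ≤_) e (≤-trans (≤-trans (m≤n+m (k + k) 3) 2k+3≤n) (m≤n+m n j)))
  ... | no i≮2k = adjacentOK-via (slot-high i≮2k) (slot-low (wrapped-shift-< i<n e))
                    (wrapped-parity {n} {k} {i} {j} n-odd k-even e)

  along-2k : AtShift (k + k) λ i j → SlotsDistance2OK (slot i) (slot j)
  along-2k i .(i + (k + k)) _ j<n (inj₁ refl) =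
    distance2OK-via (slot-low (+-cancelʳ-< (k + k) i k (<-trans j<n n<3k))) refl (SlotsDistance2OK-W (slot (i + (k + k))))
  along-2k i j _ _ (inj₂ e) with i <? k | i <? k + k | j <? k | j <? k + k
  ... | yes i<k | _ | _ | _ = distance2OK-via (slot-low i<k) refl (SlotsDistance2OK-W (slot j))
  ... | no _ | no i≮2k | _ | _ = distance2OK-via (slot-high i≮2k) refl (SlotsDistance2OK-W (slot j))
  ... | no _ | yes _ | yes j<k | _ = distance2OK-via refl (slot-low j<k) (SlotsDistance2OK-sym (SlotsDistance2OK-W (slot i)))
  ... | no _ | yes _ | no _ | no j≮2k = distance2OK-via refl (slot-high j≮2k) (SlotsDistance2OK-sym (SlotsDistance2OK-W (slot i)))
  ... | no i≮k | yes i<2k | no j≮k | yes j<2k =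
    distance2OK-via (trans (slot-mid i≮k i<2k) (cong alternating run-step)) (slot-mid j≮k j<2k)
      (SlotsDistance2OK-sym (alternating-suc ((j ∸ k) / d)))
    where
    j+d≡i : j + d ≡ i
    j+d≡i = +-cancelʳ-≡ (k + k) (j + d) i (trans (+-assoc j d (k + k)) (trans (cong (j +_) d+2k≡n) e))
    run-step : (i ∸ k) / d ≡ suc ((j ∸ k) / d)
    run-step = begin
      (i ∸ k) / d          ≡⟨ cong (λ m → (m ∸ k) / d) (sym j+d≡i) ⟩
      (j + d ∸ k) / d      ≡⟨ cong (_/ d) (+-∸-comm d (≮⇒≥ j≮k)) ⟩
      (j ∸ k + d) / d      ≡⟨ m/n≡1+[m∸n]/n (m≤n+m d _) ⟩
      suc ((j ∸ k + d ∸ d) / d) ≡⟨ cong (λ m → suc (m / d)) (m+n∸n≡m (j ∸ k) d) ⟩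
      suc ((j ∸ k) / d)    ∎
      where open ≡-Reasoning

  inner-slotting : InnerSlotting n k slot
  inner-slotting = record { along-k = along-k ; along-2k = along-2k }

  corner-free : CornerFree n k slot
  corner-free = record
    { v[n-1]   = λ i i+1≡n → ≡W⇒≢A (slot-high λ l → n≤ (≤-reflexive (sym i+1≡n)) (≤-trans l (m≤n+m (k + k) 2)))
    ; v[n-2]   = λ i i+2≡n → ≡W⇒≢A (slot-high λ l → n≤ (≤-reflexive (sym i+2≡n)) (s≤s (≤-trans l (n≤1+n _))))
    ; v[0]     = ≡W⇒≢A (slot-low k>0)
    ; v[k-1]   = λ j j+1≡k → ≡W⇒≢A (slot-low (subst (j <_) j+1≡k (n<1+n j)))
    ; v[n-1-k] = λ i i+k+1≡n → ≡B⇒≢A (trans (slot-mid (i≮k i+k+1≡n) (i<2k i+k+1≡n)) (cong alternating (run-0 i+k+1≡n)))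
    }
    where
    k>0 : 0 < k
    k>0 = n≢0⇒n>0 λ { refl → contradiction n<3k λ () }
    i≮k : ∀ {i} → suc (i + k) ≡ n → ¬ i < k
    i≮k e l = n≤ (≤-reflexive (sym e)) (≤-trans (+-monoˡ-< k l) (m≤n+m (k + k) 2))
    i<2k : ∀ {i} → suc (i + k) ≡ n → i < k + k
    i<2k {i} e = +-cancelʳ-< k i (k + k)
      (subst (i + k <_) (+-comm k (k + k)) (<-trans (subst (i + k <_) e (n<1+n (i + k))) n<3k))
    run-0 : ∀ {i} → suc (i + k) ≡ n → (i ∸ k) / d ≡ 0
    run-0 {i} e = m<n⇒m/n≡0 (+-cancelʳ-< (k + k) (i ∸ k) d (begin-strict
      i ∸ k + (k + k)   ≡⟨ sym (+-assoc (i ∸ k) k k) ⟩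
      i ∸ k + k + k     ≡⟨ cong (_+ k) (m∸n+n≡m (≮⇒≥ (i≮k e))) ⟩
      i + k             <⟨ n<1+n (i + k) ⟩
      suc (i + k)       ≡⟨ trans e (sym d+2k≡n) ⟩
      d + (k + k)       ∎))
      where open ≤-Reasoning

odd-above-double : ∀ {n k} → parity n ≡ 1ℙ → k + k < n → n ≢ suc (k + k) → 3 + (k + k) ≤ n
odd-above-double {n} {k} n-odd 2k<n n≢2k+1 = ≤∧≢⇒< (≤∧≢⇒< 2k<n (≢-sym n≢2k+1)) λ n≡2k+2 →
  contradiction (trans (sym n-odd) (trans (cong parity (sym n≡2k+2)) (parity-double k))) λ ()

odd-above-triple : ∀ {n k} → parity n ≡ 1ℙ → parity k ≡ 0ℙ → ¬ n < k + (k + k) → k + (k + k) < n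
odd-above-triple {n} {k} n-odd k-even n≮3k = ≤∧≢⇒< (≮⇒≥ n≮3k) λ 3k≡n →
  contradiction (trans (sym n-odd) (trans (cong parity (sym 3k≡n)) 3k-even)) λ ()
  where
  3k-even : parity (k + (k + k)) ≡ 0ℙ
  3k-even = trans (ℙ.+-homo-+ k (k + k)) (cong₂ _⊕_ k-even (parity-double k))

even-k≥4 : ∀ {n} k → parity k ≡ 0ℙ → 0 < k → n ≡ suc (k + k) → ¬ 5 ∣ n → 4 ≤ k
even-k≥4 (suc (suc zero)) _ _ n≡5 5∤n = contradiction (divides 1 n≡5) 5∤n
even-k≥4 (suc (suc (suc (suc _)))) _ _ _ _ = s≤s (s≤s (s≤s (s≤s z≤n)))

Petersen-coloring-odd : ∀ {n k sl} .{{_ : NonZero n}} → 0 < k → k + k < n →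
                        InnerSlotting n k sl → CornerFree n k sl → Has1122Coloring (Petersen n k)
Petersen-coloring-odd {n} {k} k>0 2k<n =
  Petersen-coloring-oddRim n k (≤-trans (s≤s (+-mono-≤ k>0 k>0)) 2k<n) k>0 (<⇒≤ 2k<n)

Petersen-coloring : ∀ n k .{{_ : NonZero n}} → 0 < k → k + k < n → ¬ 5 ∣ n → Has1122Coloring (Petersen n k)
Petersen-coloring n k k>0 2k<n 5∤n with parity n in n-par | parity k in k-par
... | 0ℙ | _  = Petersen-coloring-even n k n-par k>0 2k<n 5∤n
... | 1ℙ | 1ℙ with n ≟ suc (k + k)
...   | yes n≡2k+1 = Petersen-coloring-odd k>0 2k<n (OddKTight.inner-slotting n k k-par n≡2k+1)
                                       (OddKTight.corner-free n k k-par n≡2k+1)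
...   | no n≢2k+1 = Petersen-coloring-odd k>0 2k<n (OddKLoose.inner-slotting n k k-par 2k+3≤n)
                                      (OddKLoose.corner-free n k k-par 2k+3≤n)
  where
  2k+3≤n : 3 + (k + k) ≤ n
  2k+3≤n = odd-above-double {n} {k} n-par 2k<n n≢2k+1
Petersen-coloring n k k>0 2k<n 5∤n | 1ℙ | 0ℙ with n ≟ suc (k + k) | n <? k + (k + k)
...   | yes n≡2k+1 | _ = Petersen-coloring-odd k>0 2k<n (EvenKTight.inner-slotting n k n-par k-par n≡2k+1 4≤k)
                                           (EvenKTight.corner-free n k n-par k-par n≡2k+1 4≤k)
  where
  4≤k : 4 ≤ k
  4≤k = even-k≥4 k k-par k>0 n≡2k+1 5∤n
...   | no n≢2k+1 | yes n<3k = Petersen-coloring-odd k>0 2k<n (EvenKMedium.inner-slotting n k n-par k-par 2k+3≤n n<3k)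
                                                 (EvenKMedium.corner-free n k n-par k-par 2k+3≤n n<3k)
  where
  2k+3≤n : 3 + (k + k) ≤ n
  2k+3≤n = odd-above-double {n} {k} n-par 2k<n n≢2k+1
...   | no _ | no n≮3k = Petersen-coloring-odd k>0 2k<n (EvenKWide.inner-slotting n k n-par k-par k>0 3k<n)
                                           (EvenKWide.corner-free n k n-par k-par k>0 3k<n)
  where
  3k<n : k + (k + k) < n
  3k<n = odd-above-triple {n} {k} n-par k-par n≮3k

mainTheorem9 : (n k : ℕ) .{{_ : NonZero n}} → 0 < k → 2 * k < n → ¬ (5 ∣ n) →
    Has1122Coloring (Petersen n k) × PackingChromaticLe (Subdivision (Petersen n k)) 5
mainTheorem9 n k k>0 2k<n 5∤n = coloring , packingChromatic-subdivision≤5 (Petersen n k) coloring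
  where
  coloring : Has1122Coloring (Petersen n k)
  coloring = Petersen-coloring n k k>0 (subst (_< n) (cong (k +_) (+-identityʳ k)) 2k<n) 5∤n
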